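{- Let $P$ be a $d$-dimensional stacked polytope with $n$ vertices, and let $\Delta(P)$ be its boundary complex. If $d\geq 3$, then for every nonnegative integer $k$, $$b_k(\Delta(P))=(k-1)\binom{n-d}{k}.$$ If $d=2$, then $b_k(\Delta(P))=0$ if $k=n$, and $b_k(\Delta(P))=\frac{n(k-1)}{n-k}\binom{n-2}{k}$ otherwise.
   Context: A simplicial complex $\Delta$ on a finite set $V$ is a collection of subsets of $V$ containing every singleton and closed under taking subsets. For $W\subset V$, $\Delta_W=\{F\cap W:F\in\Delta\}$. Two vertices $u,v\in W$ are connected in $\Delta_W$ if there is a sequence $v=u_0,\ldots,u_r=u$ with $\{u_i,u_{i+1}\}\in\Delta_W$; connected components are maximal nonempty sets of pairwise connected vertices, and $\mathrm{nc}(\Delta_W)$ is their number (so $\mathrm{nc}(\Delta_\emptyset)=0$). Define $b_k(\Delta)=\sum_{W\subset V,\,|W|=k}(\mathrm{nc}(\Delta_W)-1)$ (this equals the graded Betti number $\beta_{k-1,k}$ of the Stanley–Reisner ring for $k\ge1$, and $b_0=-1$). For a simplicial polytope $P$ with vertex set $V$, the boundary complex $\Delta(P)$ is the simplicial complex on $V$ consisting of those $F\subset V$ with $F\neq V$ such that the convex hull of $F$ is a face of $P$. A $d$-dimensional stacked polytope is a simplicial polytope obtained from a $d$-dimensional simplex by finitely many steps, each of which attaches a $d$-dimensional simplex to a facet of the current polytope (i.e., glues a new simplex along that facet, adding one new vertex). -}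

module Defs where

open import Data.Bool using (Bool; true; false; _∧_; _∨_; not; if_then_else_)
open import Data.Nat using (ℕ; zero; suc; _≡ᵇ_; _<ᵇ_)
open import Data.Fin using (Fin; toℕ)
open import Data.Fin.Subset using (Subset; ⁅_⁆; _∪_; ∣_∣)
open import Data.Vec using (Vec; []; _∷_; lookup; tabulate)
open import Data.List using (List; []; _∷_; map; _++_; length)
open import Data.Bool.ListAction using (any)
open import Data.List using (allFin) renaming (filter to filterL)
open import Data.Integer using (ℤ; +_; _-_)
import Data.Integer as ℤ
open import Relation.Binary.PropositionalEquality using (_≡_)
open import Relation.Nullary.Decidable using (does)
open import Data.Bool.Properties using (T?)
open import Data.Bool using (T)

-- A simplicial complex on the vertex set Fin n, given by its (decidable)
-- face-membership predicate: Δ F ≡ true iff F is a face.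
Complex : ℕ → Set
Complex n = Subset n → Bool

subsetᵇ : ∀ {n} → Subset n → Subset n → Bool
subsetᵇ [] [] = true
subsetᵇ (true ∷ F) (g ∷ G) = g ∧ subsetᵇ F G
subsetᵇ (false ∷ F) (g ∷ G) = subsetᵇ F G

eqᵇ : ∀ {n} → Subset n → Subset n → Bool
eqᵇ F G = subsetᵇ F G ∧ subsetᵇ G F

fullᵇ : ∀ {n} → Subset n → Bool
fullᵇ [] = true
fullᵇ (x ∷ F) = x ∧ fullᵇ F

-- Start: boundary complex of the d-simplex on d+1 vertices (all proper
-- subsets of the vertex set).
-- Step: attaching a d-simplex along a facet F (a face with d vertices)
-- adds a new vertex v (placed at index 0); the new boundary complex
-- consists of the old faces except F, together with all G ∪ {v} for
-- G a proper subset of F.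

stackStep : ∀ {n} → Complex n → Subset n → Complex (suc n)
stackStep Δ F (true ∷ G) = subsetᵇ G F ∧ not (eqᵇ G F)
stackStep Δ F (false ∷ G) = Δ G ∧ not (eqᵇ G F)

data Stacked (d : ℕ) : (n : ℕ) → Complex n → Set where
  simplex : Stacked d (suc d) (λ F → not (fullᵇ F))
  stack : ∀ {n Δ} → Stacked d n Δ → (F : Subset n) →
          Δ F ≡ true → ∣ F ∣ ≡ d → Stacked d (suc n) (stackStep Δ F)

edgeᵇ : ∀ {n} → Complex n → Subset n → Fin n → Fin n → Bool
edgeᵇ Δ W u v = lookup W u ∧ lookup W v ∧ Δ (⁅ u ⁆ ∪ ⁅ v ⁆)

reachStep : ∀ {n} → Complex n → Subset n → Subset n → Subset n
reachStep {n} Δ W S =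
  tabulate (λ u → lookup S u ∨ any (λ s → lookup S s ∧ edgeᵇ Δ W s u) (allFin n))

iterate : ∀ {A : Set} → ℕ → (A → A) → A → A
iterate zero f a = a
iterate (suc m) f a = f (iterate m f a)

-- vertices connected to v in Δ_W (for v ∈ W); walks of length ≤ n suffice
reach : ∀ {n} → Complex n → Subset n → Fin n → Subset n
reach {n} Δ W v = iterate n (reachStep Δ W) ⁅ v ⁆

isRepᵇ : ∀ {n} → Complex n → Subset n → Fin n → Bool
isRepᵇ {n} Δ W v =
  lookup W v ∧ not (any (λ u → (toℕ u <ᵇ toℕ v) ∧ lookup (reach Δ W v) u) (allFin n))

nc : ∀ {n} → Complex n → Subset n → ℕ
nc {n} Δ W = length (filterL (λ v → T? (isRepᵇ Δ W v)) (allFin n))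

allSubsets : (n : ℕ) → List (Subset n)
allSubsets zero = [] ∷ []
allSubsets (suc n) = map (true ∷_) (allSubsets n) ++ map (false ∷_) (allSubsets n)

sumℤ : List ℤ → ℤ
sumℤ [] = + 0
sumℤ (x ∷ xs) = x ℤ.+ sumℤ xs

b : ∀ {n} → ℕ → Complex n → ℤ
b {n} k Δ =
  sumℤ (map (λ W → + nc Δ W - + 1)
            (filterL (λ W → T? (∣ W ∣ ≡ᵇ k)) (allSubsets n)))

module Submission where

-- Stacking onto a facet F with new vertex v gives
-- nc(Δ'_{W+v}) = nc(Δ_W) + 1 - [W ∩ F ≠ ∅] and nc(Δ'_W) = nc((Δ - F)_W), hence
--   b_{k+1}(Δ') = b_k(Δ) + C(n - |F|, k) + Σ_{|W|=k+1} (nc((Δ - F)_W) - 1).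
-- For d ≥ 3 deleting F changes no edge, the sum is b_{k+1}(Δ), and induction
-- gives (k - 1) C(n - d, k).  For d = 2 the graph is a cycle; properties of
-- cycles preserved by stacking show that deleting the edge F disconnects
-- Δ_W exactly when F ⊆ W ≠ V.

open import Defs
open import Data.Bool using (Bool; true; false; _∧_; _∨_; not; if_then_else_; T)
import Data.Bool as Bool
import Data.Bool.Properties as BoolP
open import Data.Bool.Properties using (T?)
open import Data.Bool.ListAction using (any)
open import Data.Nat using (ℕ; zero; suc; _≤_; _<_; z≤n; s≤s; _∸_; _≡ᵇ_; _<ᵇ_)
  renaming (_+_ to _+ℕ_)
import Data.Nat.Properties as NP
open import Data.Nat.Combinatorics using (_C_)
import Data.Nat.Combinatorics as NC
open import Data.Fin using (Fin; zero; suc; toℕ; _≟_)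
import Data.Fin.Properties as FP
open import Data.Vec using ([]; _∷_; lookup)
open import Data.Vec.Properties using (lookup∘tabulate; lookup-zipWith; ≡-dec; tabulate∘lookup; tabulate-cong)
import Data.List as List
import Data.List.Properties as ListP
open import Data.Fin.Subset using (Subset; ⁅_⁆; _∪_; ∣_∣) renaming (⊥ to ∅; ⊤ to 𝕍)
open import Data.Fin.Subset.Properties using (∣⁅x⁆∣≡1; ∣p∣≤n; ∣⊤∣≡n; ∣⊥∣≡0)
open import Data.Integer using (ℤ; +_; -_; _+_; _-_; _*_)
import Data.Integer.Properties as ℤP
open import Data.Integer.Tactic.RingSolver using (solve-∀)
open import Data.Product using (Σ; _×_; _,_; proj₁; proj₂)
open import Data.Sum using (_⊎_; inj₁; inj₂)
import Data.Sum as Sum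
open import Data.Empty using (⊥; ⊥-elim)
open import Data.Unit using (⊤; tt)
open import Relation.Nullary using (¬_; Dec; yes; no)
open import Relation.Nullary.Decidable using (_×-dec_; _⊎-dec_; _→-dec_; ¬?; toWitness; ⌊_⌋)
open import Relation.Binary using (tri<; tri≈; tri>)
open import Relation.Binary.PropositionalEquality

false≢true : false ≢ true
false≢true ()

∨-true : ∀ a b → a ∨ b ≡ true → a ≡ true ⊎ b ≡ true
∨-true true b _ = inj₁ refl
∨-true false b e = inj₂ e

∧-true : ∀ a b → a ∧ b ≡ true → a ≡ true × b ≡ true
∧-true true true _ = refl , refl

∨-introˡ : ∀ a b → a ≡ true → a ∨ b ≡ true
∨-introˡ true b _ = refl

∨-introʳ : ∀ a b → b ≡ true → a ∨ b ≡ true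
∨-introʳ true b _ = refl
∨-introʳ false b e = e

∧-intro : ∀ {a b} → a ≡ true → b ≡ true → a ∧ b ≡ true
∧-intro refl refl = refl

not-true : ∀ {a} → not a ≡ true → a ≡ false
not-true {false} _ = refl

bool-iff : ∀ {a b : Bool} → (a ≡ true → b ≡ true) → (b ≡ true → a ≡ true) → a ≡ b
bool-iff {true} {true} f g = refl
bool-iff {true} {false} f g = ⊥-elim (false≢true (f refl))
bool-iff {false} {true} f g = ⊥-elim (false≢true (g refl))
bool-iff {false} {false} f g = refl

-- Boolean existential quantifier over Fin n, in a form that unfolds by
-- recursion on n.
anyFin : ∀ {n} → (Fin n → Bool) → Bool
anyFin {zero} p = false
anyFin {suc n} p = p zero ∨ anyFin (λ i → p (suc i))

any-tabulate : ∀ {n} {A : Set} (p : A → Bool) (f : Fin n → A) →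
  any p (List.tabulate f) ≡ anyFin (λ i → p (f i))
any-tabulate {zero} p f = refl
any-tabulate {suc n} p f = cong (p (f zero) ∨_) (any-tabulate p (λ i → f (suc i)))

anyFin-intro : ∀ {n} (p : Fin n → Bool) i → p i ≡ true → anyFin p ≡ true
anyFin-intro p zero e = ∨-introˡ (p zero) _ e
anyFin-intro p (suc i) e = ∨-introʳ (p zero) _ (anyFin-intro (λ j → p (suc j)) i e)

anyFin-elim : ∀ {n} (p : Fin n → Bool) → anyFin p ≡ true → Σ (Fin n) λ i → p i ≡ true
anyFin-elim {suc n} p e with ∨-true (p zero) _ e
... | inj₁ h = zero , h
... | inj₂ h with anyFin-elim (λ j → p (suc j)) h
... | i , h' = suc i , h'

anyFin-false : ∀ {n} (p : Fin n → Bool) → (∀ i → p i ≡ false) → anyFin p ≡ false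
anyFin-false {zero} p h = refl
anyFin-false {suc n} p h rewrite h zero = anyFin-false (λ j → p (suc j)) (λ j → h (suc j))

anyFin-cong : ∀ {n} (p q : Fin n → Bool) → (∀ i → p i ≡ q i) → anyFin p ≡ anyFin q
anyFin-cong {zero} p q h = refl
anyFin-cong {suc n} p q h = cong₂ _∨_ (h zero) (anyFin-cong _ _ (λ i → h (suc i)))

ι : Bool → ℕ
ι true = 1
ι false = 0

count : ∀ {n} → (Fin n → Bool) → ℕ
count {zero} p = 0
count {suc n} p = ι (p zero) +ℕ count (λ i → p (suc i))

length-filter-tabulate : ∀ {n} {A : Set} (p : A → Bool) (f : Fin n → A) →
  List.length (List.filter (λ a → T? (p a)) (List.tabulate f)) ≡ count (λ i → p (f i))
length-filter-tabulate {zero} p f = refl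
length-filter-tabulate {suc n} p f with p (f zero)
... | true = cong suc (length-filter-tabulate p (λ i → f (suc i)))
... | false = length-filter-tabulate p (λ i → f (suc i))

count-cong : ∀ {n} (p q : Fin n → Bool) → (∀ i → p i ≡ q i) → count p ≡ count q
count-cong {zero} p q h = refl
count-cong {suc n} p q h = cong₂ _+ℕ_ (cong ι (h zero)) (count-cong _ _ (λ i → h (suc i)))

count-none : ∀ {n} (p : Fin n → Bool) → (∀ i → p i ≡ false) → count p ≡ 0
count-none {zero} p h = refl
count-none {suc n} p h rewrite h zero = count-none _ (λ i → h (suc i))

count-unique : ∀ {n} (p : Fin n → Bool) (m : Fin n) → p m ≡ true →
  (∀ i → p i ≡ true → i ≡ m) → count p ≡ 1
count-unique {suc n} p zero hm hu rewrite hm = cong suc (count-none _ others)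
  where
  others : ∀ i → p (suc i) ≡ false
  others i with p (suc i) in e
  ... | false = refl
  ... | true with hu (suc i) e
  ... | ()
count-unique {suc n} p (suc m) hm hu with p zero in e
... | true with hu zero e
... | ()
count-unique {suc n} p (suc m) hm hu | false =
  count-unique _ m hm (λ i h → FP.suc-injective (hu (suc i) h))

count-split : ∀ {n} (p q : Fin n → Bool) →
  count p ≡ count (λ i → p i ∧ q i) +ℕ count (λ i → p i ∧ not (q i))
count-split {zero} p q = refl
count-split {suc n} p q =
  begin
    ι (p zero) +ℕ count (λ i → p (suc i))
  ≡⟨ cong₂ _+ℕ_ (ι-split (p zero) (q zero)) (count-split _ (λ i → q (suc i))) ⟩
    (x +ℕ y) +ℕ (X +ℕ Y)
  ≡⟨ NP.+-assoc x y (X +ℕ Y) ⟩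
    x +ℕ (y +ℕ (X +ℕ Y))
  ≡⟨ cong (x +ℕ_) (NP.+-comm y (X +ℕ Y)) ⟩
    x +ℕ ((X +ℕ Y) +ℕ y)
  ≡⟨ cong (x +ℕ_) (NP.+-assoc X Y y) ⟩
    x +ℕ (X +ℕ (Y +ℕ y))
  ≡⟨ cong (λ z → x +ℕ (X +ℕ z)) (NP.+-comm Y y) ⟩
    x +ℕ (X +ℕ (y +ℕ Y))
  ≡⟨ sym (NP.+-assoc x X (y +ℕ Y)) ⟩
    (x +ℕ X) +ℕ (y +ℕ Y)
  ∎
  where
  open ≡-Reasoning
  ι-split : ∀ a b → ι a ≡ ι (a ∧ b) +ℕ ι (a ∧ not b)
  ι-split true true = refl
  ι-split true false = refl
  ι-split false b = refl
  x = ι (p zero ∧ q zero)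
  y = ι (p zero ∧ not (q zero))
  X = count (λ i → p (suc i) ∧ q (suc i))
  Y = count (λ i → p (suc i) ∧ not (q (suc i)))

_⊆ˡ_ : ∀ {n} → Subset n → Subset n → Set
_⊆ˡ_ {n} p q = ∀ (i : Fin n) → lookup p i ≡ true → lookup q i ≡ true

⊆ˡ⇒∣∣≤ : ∀ {n} (p q : Subset n) → p ⊆ˡ q → ∣ p ∣ ≤ ∣ q ∣
⊆ˡ⇒∣∣≤ [] [] h = z≤n
⊆ˡ⇒∣∣≤ (true ∷ p) (true ∷ q) h = s≤s (⊆ˡ⇒∣∣≤ p q (λ i → h (suc i)))
⊆ˡ⇒∣∣≤ (true ∷ p) (false ∷ q) h with h zero refl
... | ()
⊆ˡ⇒∣∣≤ (false ∷ p) (true ∷ q) h = NP.m≤n⇒m≤1+n (⊆ˡ⇒∣∣≤ p q (λ i → h (suc i)))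
⊆ˡ⇒∣∣≤ (false ∷ p) (false ∷ q) h = ⊆ˡ⇒∣∣≤ p q (λ i → h (suc i))

⊆ˡ⇒∣∣< : ∀ {n} (p q : Subset n) → p ⊆ˡ q → p ≢ q → ∣ p ∣ < ∣ q ∣
⊆ˡ⇒∣∣< [] [] h ne = ⊥-elim (ne refl)
⊆ˡ⇒∣∣< (true ∷ p) (true ∷ q) h ne =
  s≤s (⊆ˡ⇒∣∣< p q (λ i → h (suc i)) (λ e → ne (cong (true ∷_) e)))
⊆ˡ⇒∣∣< (true ∷ p) (false ∷ q) h ne with h zero refl
... | ()
⊆ˡ⇒∣∣< (false ∷ p) (true ∷ q) h ne = s≤s (⊆ˡ⇒∣∣≤ p q (λ i → h (suc i)))
⊆ˡ⇒∣∣< (false ∷ p) (false ∷ q) h ne =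
  ⊆ˡ⇒∣∣< p q (λ i → h (suc i)) (λ e → ne (cong (false ∷_) e))

lookup-∅ : ∀ {n} (i : Fin n) → lookup (∅ {n}) i ≡ false
lookup-∅ zero = refl
lookup-∅ (suc i) = lookup-∅ i

lookup-𝕍 : ∀ {n} (i : Fin n) → lookup (𝕍 {n}) i ≡ true
lookup-𝕍 zero = refl
lookup-𝕍 (suc i) = lookup-𝕍 i

∈⁅⁆⇒≡ : ∀ {n} (v u : Fin n) → lookup ⁅ v ⁆ u ≡ true → u ≡ v
∈⁅⁆⇒≡ zero zero e = refl
∈⁅⁆⇒≡ zero (suc u) e = ⊥-elim (false≢true (trans (sym (lookup-∅ u)) e))
∈⁅⁆⇒≡ (suc v) (suc u) e = cong suc (∈⁅⁆⇒≡ v u e)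

∈⁅x⁆ : ∀ {n} (v : Fin n) → lookup ⁅ v ⁆ v ≡ true
∈⁅x⁆ zero = refl
∈⁅x⁆ (suc v) = ∈⁅x⁆ v

data Path {n} (E : Fin n → Fin n → Bool) : Fin n → Fin n → Set where
  here : ∀ {x} → Path E x x
  step : ∀ {x y z} → E x y ≡ true → Path E y z → Path E x z

_++ₚ_ : ∀ {n} {E : Fin n → Fin n → Bool} {x y z} → Path E x y → Path E y z → Path E x z
here ++ₚ q = q
step e p ++ₚ q = step e (p ++ₚ q)

snocₚ : ∀ {n} {E : Fin n → Fin n → Bool} {x y z} → Path E x y → E y z ≡ true → Path E x z
snocₚ p e = p ++ₚ step e here

Symmetric : ∀ {n} → (Fin n → Fin n → Bool) → Set
Symmetric E = ∀ x y → E x y ≡ true → E y x ≡ true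

reverseₚ : ∀ {n} {E : Fin n → Fin n → Bool} → Symmetric E → ∀ {x y} → Path E x y → Path E y x
reverseₚ s here = here
reverseₚ s (step e p) = snocₚ (reverseₚ s p) (s _ _ e)

bindₚ : ∀ {n m} {E : Fin n → Fin n → Bool} {E' : Fin m → Fin m → Bool} (f : Fin n → Fin m) →
  (∀ x y → E x y ≡ true → Path E' (f x) (f y)) → ∀ {x y} → Path E x y → Path E' (f x) (f y)
bindₚ f h here = here
bindₚ f h (step e p) = h _ _ e ++ₚ bindₚ f h p

mapₚ : ∀ {n m} {E : Fin n → Fin n → Bool} {E' : Fin m → Fin m → Bool} (f : Fin n → Fin m) →
  (∀ x y → E x y ≡ true → E' (f x) (f y) ≡ true) → ∀ {x y} → Path E x y → Path E' (f x) (f y)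
mapₚ f h = bindₚ f (λ x y e → step (h x y e) here)

-- The
-- search only grows, so it stabilises within n rounds, and a stable set is
-- closed under edges.
module Search {n} (Δ : Complex n) (W : Subset n) (v : Fin n) where
  E : Fin n → Fin n → Bool
  E = edgeᵇ Δ W

  S : ℕ → Subset n
  S m = iterate m (reachStep Δ W) ⁅ v ⁆

  reachStep-lookup : ∀ (T : Subset n) u →
    lookup (reachStep Δ W T) u ≡ (lookup T u ∨ anyFin (λ s → lookup T s ∧ E s u))
  reachStep-lookup T u = trans (lookup∘tabulate _ u)
    (cong (lookup T u ∨_) (any-tabulate (λ s → lookup T s ∧ E s u) (λ i → i)))

  grows : ∀ m → S m ⊆ˡ S (suc m)
  grows m u h = trans (reachStep-lookup (S m) u) (∨-introˡ _ _ h)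

  spreads : ∀ T s u → lookup T s ≡ true → E s u ≡ true → lookup (reachStep Δ W T) u ≡ true
  spreads T s u h e = trans (reachStep-lookup T u)
    (∨-introʳ (lookup T u) _ (anyFin-intro _ s (∧-intro h e)))

  sound : ∀ m u → lookup (S m) u ≡ true → Path E v u
  sound zero u h rewrite ∈⁅⁆⇒≡ v u h = here
  sound (suc m) u h with ∨-true _ _ (trans (sym (reachStep-lookup (S m) u)) h)
  ... | inj₁ old = sound m u old
  ... | inj₂ new with anyFin-elim _ new
  ... | s , hs with ∧-true (lookup (S m) s) _ hs
  ... | hs' , e = snocₚ (sound m s hs') e

  stable-or-large : ∀ m → (Σ ℕ λ i → i ≤ m × S i ≡ S (suc i)) ⊎ (suc m ≤ ∣ S m ∣)
  stable-or-large zero = inj₂ (NP.≤-reflexive (sym (∣⁅x⁆∣≡1 v)))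
  stable-or-large (suc m) with stable-or-large m
  ... | inj₁ (i , i≤m , e) = inj₁ (i , NP.m≤n⇒m≤1+n i≤m , e)
  ... | inj₂ large with ≡-dec Bool._≟_ (S m) (S (suc m))
  ... | yes e = inj₁ (m , NP.n≤1+n m , e)
  ... | no ne = inj₂ (NP.≤-trans (s≤s large) (⊆ˡ⇒∣∣< (S m) (S (suc m)) (grows m) ne))

  stabilises : Σ ℕ λ i → i ≤ n × S i ≡ S (suc i)
  stabilises with stable-or-large n
  ... | inj₁ r = r
  ... | inj₂ large = ⊥-elim (NP.<⇒≱ large (∣p∣≤n (S n)))

  stays : ∀ i → S i ≡ S (suc i) → ∀ k → S (k +ℕ i) ≡ S i
  stays i e zero = refl
  stays i e (suc k) = trans (cong (reachStep Δ W) (stays i e k)) (sym e)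

  closed : ∀ s u → lookup (S n) s ≡ true → E s u ≡ true → lookup (S n) u ≡ true
  closed s u h e with stabilises
  ... | i , i≤n , fixed =
    subst (λ T → lookup T u ≡ true) (trans Sn+1≡Si (sym Sn≡Si)) (spreads (S n) s u h e)
    where
    Sn≡Si : S n ≡ S i
    Sn≡Si = trans (cong S (sym (NP.m∸n+n≡m i≤n))) (stays i fixed (n ∸ i))
    Sn+1≡Si : S (suc n) ≡ S i
    Sn+1≡Si = trans (cong (λ k → S (suc k)) (sym (NP.m∸n+n≡m i≤n))) (stays i fixed (suc (n ∸ i)))

  contains-start : ∀ m → lookup (S m) v ≡ true
  contains-start zero = ∈⁅x⁆ v
  contains-start (suc m) = grows m v (contains-start m)

  complete : ∀ {x u} → lookup (S n) x ≡ true → Path E x u → lookup (S n) u ≡ true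
  complete h here = h
  complete h (step e p) = complete (closed _ _ h e) p

reach-sound : ∀ {n} (Δ : Complex n) W v u → lookup (reach Δ W v) u ≡ true → Path (edgeᵇ Δ W) v u
reach-sound {n} Δ W v u = Search.sound Δ W v n u

reach-complete : ∀ {n} (Δ : Complex n) W v u → Path (edgeᵇ Δ W) v u → lookup (reach Δ W v) u ≡ true
reach-complete {n} Δ W v u = Search.complete Δ W v (Search.contains-start Δ W v n)

-- Counting the classes of an equivalence relation R on a set W ⊆ Fin n by
-- their least elements.  With R v u = "u is reachable from v" this is nc.

isLeast : ∀ {n} → (Fin n → Bool) → (Fin n → Fin n → Bool) → Fin n → Bool
isLeast W R v = W v ∧ not (anyFin (λ u → (toℕ u <ᵇ toℕ v) ∧ R v u))

classes : ∀ {n} → (Fin n → Bool) → (Fin n → Fin n → Bool) → ℕ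
classes W R = count (isLeast W R)

Reach : ∀ {n} → Complex n → Subset n → Fin n → Fin n → Bool
Reach Δ W v u = lookup (reach Δ W v) u

nc≡classes : ∀ {n} (Δ : Complex n) (W : Subset n) → nc Δ W ≡ classes (lookup W) (Reach Δ W)
nc≡classes Δ W = trans (length-filter-tabulate (isRepᵇ Δ W) (λ i → i))
  (count-cong _ _ (λ v → cong (λ z → lookup W v ∧ not z)
     (any-tabulate (λ u → (toℕ u <ᵇ toℕ v) ∧ Reach Δ W v u) (λ i → i))))

classes-cong : ∀ {n} (W : Fin n → Bool) (R R' : Fin n → Fin n → Bool) →
  (∀ v → W v ≡ true → ∀ u → R v u ≡ R' v u) → classes W R ≡ classes W R'
classes-cong W R R' h = count-cong _ _ same
  where
  same : ∀ v → isLeast W R v ≡ isLeast W R' v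
  same v with W v in e
  ... | false = refl
  ... | true = cong not (anyFin-cong _ _ (λ u → cong ((toℕ u <ᵇ toℕ v) ∧_) (h v e u)))

<ᵇ-true⇒< : ∀ m n → (m <ᵇ n) ≡ true → m < n
<ᵇ-true⇒< m n e = NP.<ᵇ⇒< m n (subst T (sym e) tt)

<⇒<ᵇ-true : ∀ {m n} → m < n → (m <ᵇ n) ≡ true
<⇒<ᵇ-true {zero} {suc n} _ = refl
<⇒<ᵇ-true {suc m} {suc n} (s≤s h) = <⇒<ᵇ-true h

record IsEquivOn {n} (W : Fin n → Bool) (R : Fin n → Fin n → Bool) : Set where
  field
    refl-on : ∀ a → W a ≡ true → R a a ≡ true
    sym-on : ∀ a b → W a ≡ true → R a b ≡ true → R b a ≡ true
    trans-on : ∀ a b c → W a ≡ true → R a b ≡ true → R b c ≡ true → R a c ≡ true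
    closed-on : ∀ a b → W a ≡ true → R a b ≡ true → W b ≡ true

module LeastElements {n} (W : Fin n → Bool) (R : Fin n → Fin n → Bool) (eqv : IsEquivOn W R) where
  open IsEquivOn eqv

  least-in : ∀ v → isLeast W R v ≡ true → W v ≡ true
  least-in v h = proj₁ (∧-true _ _ h)

  least-minimal : ∀ v u → isLeast W R v ≡ true → toℕ u < toℕ v → R v u ≡ true → ⊥
  least-minimal v u h lt r = false≢true
    (trans (sym (not-true (proj₂ (∧-true _ _ h)))) (anyFin-intro _ u (∧-intro (<⇒<ᵇ-true lt) r)))

  least-intro : ∀ v → W v ≡ true → (∀ u → toℕ u < toℕ v → R v u ≡ true → ⊥) → isLeast W R v ≡ true
  least-intro v w h with anyFin (λ u → (toℕ u <ᵇ toℕ v) ∧ R v u) in e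
  ... | false rewrite w = refl
  ... | true with anyFin-elim _ e
  ... | u , hu with ∧-true _ _ hu
  ... | lt , r = ⊥-elim (h u (<ᵇ-true⇒< _ _ lt) r)

  least-unique : ∀ m m' → isLeast W R m ≡ true → isLeast W R m' ≡ true → R m m' ≡ true → m ≡ m'
  least-unique m m' h h' r with NP.<-cmp (toℕ m) (toℕ m')
  ... | tri< lt _ _ = ⊥-elim (least-minimal m' m h' lt (sym-on m m' (least-in m h) r))
  ... | tri≈ _ eq _ = FP.toℕ-injective eq
  ... | tri> _ _ gt = ⊥-elim (least-minimal m m' h gt r)

  -- Descend along smaller related elements; the bound k makes this terminate.
  least-below : ∀ k a → toℕ a < k → W a ≡ true → Σ (Fin n) λ m → isLeast W R m ≡ true × R a m ≡ true
  least-below (suc k) a lt w with anyFin (λ u → (toℕ u <ᵇ toℕ a) ∧ R a u) in e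
  ... | false = a , least-intro a w none , refl-on a w
    where
    none : ∀ u → toℕ u < toℕ a → R a u ≡ true → ⊥
    none u l r = false≢true (trans (sym e) (anyFin-intro _ u (∧-intro (<⇒<ᵇ-true l) r)))
  ... | true with anyFin-elim _ e
  ... | u , hu with ∧-true _ _ hu
  ... | u<a , rau with least-below k u (NP.<-≤-trans (<ᵇ-true⇒< _ _ u<a) (NP.≤-pred lt)) (closed-on a u w rau)
  ... | m , hm , rum = m , hm , trans-on a u m w rau rum

  least-of : ∀ a → W a ≡ true → Σ (Fin n) λ m → isLeast W R m ≡ true × R a m ≡ true
  least-of a w = least-below n a (FP.toℕ<n a) w

module ClassesMeetingClique {n} (W : Fin n → Bool) (R : Fin n → Fin n → Bool) (eqv : IsEquivOn W R)
  (A : Fin n → Bool) (A⊆W : ∀ a → A a ≡ true → W a ≡ true)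
  (clique : ∀ a b → A a ≡ true → A b ≡ true → R a b ≡ true) where
  open IsEquivOn eqv
  open LeastElements W R eqv

  meetsA : Fin n → Bool
  meetsA i = anyFin (λ a → A a ∧ R i a)

  meeting : count (λ i → isLeast W R i ∧ meetsA i) ≡ ι (anyFin A)
  meeting with anyFin A in e
  ... | false = count-none _ none
    where
    none : ∀ i → (isLeast W R i ∧ meetsA i) ≡ false
    none i with meetsA i in e'
    ... | false = BoolP.∧-zeroʳ _
    ... | true with anyFin-elim _ e'
    ... | a , h = ⊥-elim (false≢true (trans (sym e) (anyFin-intro A a (proj₁ (∧-true _ _ h)))))
  ... | true with anyFin-elim A e
  ... | a , ha with least-of a (A⊆W a ha)
  ... | m , hm , ram = count-unique _ m (∧-intro hm m-meets) only-m
    where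
    m-meets : meetsA m ≡ true
    m-meets = anyFin-intro _ a (∧-intro ha (sym-on a m (A⊆W a ha) ram))
    only-m : ∀ i → (isLeast W R i ∧ meetsA i) ≡ true → i ≡ m
    only-m i h with ∧-true _ _ h
    ... | hi , hmeet with anyFin-elim _ hmeet
    ... | a' , h' with ∧-true _ _ h'
    ... | ha' , ria' =
      least-unique i m hi hm (trans-on i a m wi (trans-on i a' a wi ria' (clique a' a ha' ha)) ram)
      where wi = least-in i hi

  classes-meeting-clique : count (λ i → isLeast W R i ∧ not (meetsA i)) +ℕ ι (anyFin A) ≡ classes W R
  classes-meeting-clique =
    trans (NP.+-comm _ (ι (anyFin A)))
      (trans (cong (_+ℕ count (λ i → isLeast W R i ∧ not (meetsA i))) (sym meeting))
        (sym (count-split (isLeast W R) meetsA)))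

module SplitOneClass {n} (W : Fin n → Bool) (R₀ R : Fin n → Fin n → Bool)
  (eqv₀ : IsEquivOn W R₀) (eqv : IsEquivOn W R)
  (R₀⊆R : ∀ i j → W i ≡ true → R₀ i j ≡ true → R i j ≡ true)
  (a b : Fin n) (wa : W a ≡ true) (wb : W b ≡ true) (Rab : R a b ≡ true) (¬R₀ab : R₀ a b ≡ false)
  (splits : ∀ i j → W i ≡ true → R i j ≡ true →
     R₀ i j ≡ true ⊎ (R₀ i a ≡ true × R₀ b j ≡ true) ⊎ (R₀ i b ≡ true × R₀ a j ≡ true)) where
  module E₀ = IsEquivOn eqv₀
  module E = IsEquivOn eqv
  module L₀ = LeastElements W R₀ eqv₀
  module L = LeastElements W R eqv

  least⇒least₀ : ∀ i → isLeast W R i ≡ true → isLeast W R₀ i ≡ true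
  least⇒least₀ i h = L₀.least-intro i (L.least-in i h)
    (λ u lt r → L.least-minimal i u h lt (R₀⊆R i u (L.least-in i h) r))

  ma = proj₁ (L₀.least-of a wa)
  mb = proj₁ (L₀.least-of b wb)
  ma-least = proj₁ (proj₂ (L₀.least-of a wa))
  mb-least = proj₁ (proj₂ (L₀.least-of b wb))
  a~ma = proj₂ (proj₂ (L₀.least-of a wa))
  b~mb = proj₂ (proj₂ (L₀.least-of b wb))

  ma≢mb : ma ≢ mb
  ma≢mb eq = false≢true (trans (sym ¬R₀ab) a~b)
    where
    a~b : R₀ a b ≡ true
    a~b = E₀.trans-on a ma b wa a~ma (E₀.sym-on b ma wb (subst (λ z → R₀ b z ≡ true) (sym eq) b~mb))

  -- ma, mb are R-related, so the larger one is not R-least.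
  ma~mb : R ma mb ≡ true
  ma~mb = E.trans-on ma a mb wma (R₀⊆R ma a wma (E₀.sym-on a ma wa a~ma))
            (E.trans-on a b mb wa Rab (R₀⊆R b mb wb b~mb))
    where wma = L₀.least-in ma ma-least

  larger-not-least : ∀ {x y} → toℕ y < toℕ x → R x y ≡ true → isLeast W R x ≡ false
  larger-not-least {x} {y} lt r with isLeast W R x in e
  ... | false = refl
  ... | true = ⊥-elim (L.least-minimal x y e lt r)

  least-bound : ∀ c m → W c ≡ true → isLeast W R₀ m ≡ true → R₀ c m ≡ true →
    ∀ j → R₀ c j ≡ true → toℕ m ≤ toℕ j
  least-bound c m wc hm c~m j c~j = NP.≮⇒≥ (λ lt → L₀.least-minimal m j hm lt
    (E₀.trans-on m c j (L₀.least-in m hm) (E₀.sym-on c m wc c~m) c~j))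

  lost : ∀ i → isLeast W R₀ i ≡ true → isLeast W R i ≡ false →
    (i ≡ ma × toℕ mb < toℕ ma) ⊎ (i ≡ mb × toℕ ma < toℕ mb)
  lost i h₀ h with anyFin (λ u → (toℕ u <ᵇ toℕ i) ∧ R i u) in e
  ... | false rewrite L₀.least-in i h₀ = ⊥-elim (false≢true (sym h))
  ... | true with anyFin-elim _ e
  ... | j , hj with ∧-true _ _ hj
  ... | j<i , Rij with splits i j wi Rij
    where wi = L₀.least-in i h₀
  ... | inj₁ r = ⊥-elim (L₀.least-minimal i j h₀ (<ᵇ-true⇒< _ _ j<i) r)
  ... | inj₂ (inj₁ (i~a , b~j)) =
    inj₁ (i≡ma , NP.≤-<-trans (least-bound b mb wb mb-least b~mb j b~j)
                   (subst (λ z → toℕ j < toℕ z) i≡ma (<ᵇ-true⇒< _ _ j<i)))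
    where
    i≡ma : i ≡ ma
    i≡ma = L₀.least-unique i ma h₀ ma-least (E₀.trans-on i a ma (L₀.least-in i h₀) i~a a~ma)
  ... | inj₂ (inj₂ (i~b , a~j)) =
    inj₂ (i≡mb , NP.≤-<-trans (least-bound a ma wa ma-least a~ma j a~j)
                   (subst (λ z → toℕ j < toℕ z) i≡mb (<ᵇ-true⇒< _ _ j<i)))
    where
    i≡mb : i ≡ mb
    i≡mb = L₀.least-unique i mb h₀ mb-least (E₀.trans-on i b mb (L₀.least-in i h₀) i~b b~mb)

  lostᵇ : Fin n → Bool
  lostᵇ i = isLeast W R₀ i ∧ not (isLeast W R i)

  lost-one : count lostᵇ ≡ 1
  lost-one with NP.<-cmp (toℕ ma) (toℕ mb)
  ... | tri≈ _ eq _ = ⊥-elim (ma≢mb (FP.toℕ-injective eq))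
  ... | tri< lt _ _ = count-unique lostᵇ mb
        (∧-intro mb-least (cong not (larger-not-least lt (E.sym-on ma mb wma ma~mb)))) only
    where
    wma = L₀.least-in ma ma-least
    only : ∀ i → lostᵇ i ≡ true → i ≡ mb
    only i h with ∧-true _ _ h
    ... | h₀ , h₁ with lost i h₀ (not-true h₁)
    ... | inj₁ (_ , lt') = ⊥-elim (NP.<-asym lt lt')
    ... | inj₂ (e , _) = e
  ... | tri> _ _ gt = count-unique lostᵇ ma
        (∧-intro ma-least (cong not (larger-not-least gt ma~mb))) only
    where
    only : ∀ i → lostᵇ i ≡ true → i ≡ ma
    only i h with ∧-true _ _ h
    ... | h₀ , h₁ with lost i h₀ (not-true h₁)
    ... | inj₁ (e , _) = e
    ... | inj₂ (_ , lt') = ⊥-elim (NP.<-asym gt lt')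

  classes-split : classes W R₀ ≡ suc (classes W R)
  classes-split = trans (count-split (isLeast W R₀) (isLeast W R))
    (trans (cong₂ _+ℕ_ (count-cong _ _ kept) lost-one) (NP.+-comm _ 1))
    where
    kept : ∀ i → (isLeast W R₀ i ∧ isLeast W R i) ≡ isLeast W R i
    kept i with isLeast W R i in e
    ... | true = trans (cong (_∧ true) (least⇒least₀ i e)) refl
    ... | false = BoolP.∧-zeroʳ _

-- Adding a vertex 0 (present iff x) that is least by position:  0 is one new
-- class, and an old least element i survives iff it is not related to 0 (G i).
module ExtendByZero {n} (x : Bool) (W : Fin n → Bool) (R : Fin n → Fin n → Bool)
  (R* : Fin (suc n) → Fin (suc n) → Bool) (G : Fin n → Bool)
  (old : ∀ i j → W i ≡ true → R* (suc i) (suc j) ≡ R i j)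
  (to-zero : ∀ i → W i ≡ true → R* (suc i) zero ≡ G i) where

  W* : Fin (suc n) → Bool
  W* zero = x
  W* (suc i) = W i

  least-zero : isLeast W* R* zero ≡ x
  least-zero = trans (cong (λ z → x ∧ not z) (anyFin-false _ (λ u → cong (_∧ R* zero u) (nothing-below (toℕ u)))))
                 (BoolP.∧-identityʳ x)
    where
    nothing-below : ∀ m → (m <ᵇ 0) ≡ false
    nothing-below zero = refl
    nothing-below (suc m) = refl

  least-suc : ∀ i → isLeast W* R* (suc i) ≡ (isLeast W R i ∧ not (G i))
  least-suc i with W i in e
  ... | false = refl
  ... | true =
    trans (cong (λ z → not (z ∨ anyFin (λ j → (toℕ j <ᵇ toℕ i) ∧ R* (suc i) (suc j)))) (to-zero i e))
      (trans (cong (λ z → not (G i ∨ z)) (anyFin-cong _ _ (λ j → cong ((toℕ j <ᵇ toℕ i) ∧_) (old i j e))))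
        (de-morgan (G i) _))
    where
    de-morgan : ∀ g y → not (g ∨ y) ≡ (not y ∧ not g)
    de-morgan true y = sym (BoolP.∧-zeroʳ _)
    de-morgan false y = sym (BoolP.∧-identityʳ _)

  classes-extend : classes W* R* ≡ ι x +ℕ count (λ i → isLeast W R i ∧ not (G i))
  classes-extend = cong₂ _+ℕ_ (cong ι least-zero) (count-cong _ _ least-suc)

pair : ∀ {n} → Fin n → Fin n → Subset n
pair u w = ⁅ u ⁆ ∪ ⁅ w ⁆

subset-ext : ∀ {n} (p q : Subset n) → (∀ i → lookup p i ≡ lookup q i) → p ≡ q
subset-ext p q h = trans (sym (tabulate∘lookup p)) (trans (tabulate-cong h) (tabulate∘lookup q))

lookup-∪ : ∀ {n} (p q : Subset n) i → lookup (p ∪ q) i ≡ (lookup p i ∨ lookup q i)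
lookup-∪ p q i = lookup-zipWith _∨_ i p q

∅∪ : ∀ {n} (p : Subset n) → ∅ ∪ p ≡ p
∅∪ p = subset-ext _ _ (λ i → trans (lookup-∪ ∅ p i) (cong (_∨ lookup p i) (lookup-∅ i)))

∪∅ : ∀ {n} (p : Subset n) → p ∪ ∅ ≡ p
∪∅ p = subset-ext _ _ (λ i →
  trans (lookup-∪ p ∅ i) (trans (cong (lookup p i ∨_) (lookup-∅ i)) (BoolP.∨-identityʳ _)))

pair-comm : ∀ {n} (u w : Fin n) → pair u w ≡ pair w u
pair-comm u w = subset-ext _ _ (λ i →
  trans (lookup-∪ ⁅ u ⁆ ⁅ w ⁆ i) (trans (BoolP.∨-comm (lookup ⁅ u ⁆ i) _) (sym (lookup-∪ ⁅ w ⁆ ⁅ u ⁆ i))))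

∈pair : ∀ {n} (u w i : Fin n) → lookup (pair u w) i ≡ true → i ≡ u ⊎ i ≡ w
∈pair u w i h with ∨-true _ _ (trans (sym (lookup-∪ ⁅ u ⁆ ⁅ w ⁆ i)) h)
... | inj₁ h₁ = inj₁ (∈⁅⁆⇒≡ u i h₁)
... | inj₂ h₂ = inj₂ (∈⁅⁆⇒≡ w i h₂)

∈pairˡ : ∀ {n} (u w : Fin n) → lookup (pair u w) u ≡ true
∈pairˡ u w = trans (lookup-∪ ⁅ u ⁆ ⁅ w ⁆ u) (∨-introˡ _ _ (∈⁅x⁆ u))

∈pairʳ : ∀ {n} (u w : Fin n) → lookup (pair u w) w ≡ true
∈pairʳ u w = trans (lookup-∪ ⁅ u ⁆ ⁅ w ⁆ w) (∨-introʳ _ _ (∈⁅x⁆ w))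

∈pair⁺ : ∀ {n} (u w y : Fin n) → y ≡ u ⊎ y ≡ w → lookup (pair u w) y ≡ true
∈pair⁺ u w y (inj₁ refl) = ∈pairˡ u w
∈pair⁺ u w y (inj₂ refl) = ∈pairʳ u w

∣∪∣≤ : ∀ {n} (p q : Subset n) → ∣ p ∪ q ∣ ≤ ∣ p ∣ +ℕ ∣ q ∣
∣∪∣≤ [] [] = z≤n
∣∪∣≤ (true ∷ p) (true ∷ q) = s≤s (NP.≤-trans (∣∪∣≤ p q) (NP.+-monoʳ-≤ ∣ p ∣ (NP.n≤1+n _)))
∣∪∣≤ (true ∷ p) (false ∷ q) = s≤s (∣∪∣≤ p q)
∣∪∣≤ (false ∷ p) (true ∷ q) = NP.≤-trans (s≤s (∣∪∣≤ p q)) (NP.≤-reflexive (sym (NP.+-suc _ _)))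
∣∪∣≤ (false ∷ p) (false ∷ q) = ∣∪∣≤ p q

∣pair∣≤2 : ∀ {n} (u w : Fin n) → ∣ pair u w ∣ ≤ 2
∣pair∣≤2 u w = NP.≤-trans (∣∪∣≤ ⁅ u ⁆ ⁅ w ⁆) (NP.≤-reflexive (cong₂ _+ℕ_ (∣⁅x⁆∣≡1 u) (∣⁅x⁆∣≡1 w)))

subsetᵇ-sound : ∀ {n} (G F : Subset n) → subsetᵇ G F ≡ true → G ⊆ˡ F
subsetᵇ-sound (true ∷ G) (true ∷ F) h zero _ = refl
subsetᵇ-sound (true ∷ G) (false ∷ F) () i
subsetᵇ-sound (true ∷ G) (true ∷ F) h (suc i) hi = subsetᵇ-sound G F h i hi
subsetᵇ-sound (false ∷ G) (f ∷ F) h (suc i) hi = subsetᵇ-sound G F h i hi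

subsetᵇ-complete : ∀ {n} (G F : Subset n) → G ⊆ˡ F → subsetᵇ G F ≡ true
subsetᵇ-complete [] [] h = refl
subsetᵇ-complete (true ∷ G) (f ∷ F) h rewrite h zero refl = subsetᵇ-complete G F (λ i → h (suc i))
subsetᵇ-complete (false ∷ G) (f ∷ F) h = subsetᵇ-complete G F (λ i → h (suc i))

eqᵇ⇒≡ : ∀ {n} (G F : Subset n) → eqᵇ G F ≡ true → G ≡ F
eqᵇ⇒≡ G F h with ∧-true _ _ h
... | h₁ , h₂ = subset-ext G F (λ i → bool-iff (subsetᵇ-sound G F h₁ i) (subsetᵇ-sound F G h₂ i))

eqᵇ-refl : ∀ {n} (G : Subset n) → eqᵇ G G ≡ true
eqᵇ-refl G = ∧-intro (subsetᵇ-complete G G (λ i h → h)) (subsetᵇ-complete G G (λ i h → h))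

eqᵇ-size : ∀ {n} (G F : Subset n) → ∣ G ∣ ≢ ∣ F ∣ → eqᵇ G F ≡ false
eqᵇ-size G F ne with eqᵇ G F in e
... | false = refl
... | true = ⊥-elim (ne (cong ∣_∣ (eqᵇ⇒≡ G F e)))

edge≢large : ∀ {n} (u w : Fin n) (F : Subset n) → 3 ≤ ∣ F ∣ → eqᵇ (pair u w) F ≡ false
edge≢large u w F F3 = eqᵇ-size (pair u w) F
  (λ e → NP.<-irrefl e (NP.≤-<-trans (∣pair∣≤2 u w) (NP.<-≤-trans (NP.n<1+n 2) F3)))

subsetᵇ-⁅⁆ : ∀ {n} (j : Fin n) (F : Subset n) → subsetᵇ ⁅ j ⁆ F ≡ lookup F j
subsetᵇ-⁅⁆ j F = bool-iff (λ h → subsetᵇ-sound ⁅ j ⁆ F h j (∈⁅x⁆ j))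
  (λ h → subsetᵇ-complete ⁅ j ⁆ F (λ i hi → subst (λ z → lookup F z ≡ true) (sym (∈⁅⁆⇒≡ j i hi)) h))

subsetᵇ-pair : ∀ {n} (a b : Fin n) (W : Subset n) → subsetᵇ (pair a b) W ≡ (lookup W a ∧ lookup W b)
subsetᵇ-pair a b W = bool-iff
  (λ h → ∧-intro (subsetᵇ-sound (pair a b) W h a (∈pairˡ a b)) (subsetᵇ-sound (pair a b) W h b (∈pairʳ a b)))
  (λ h → subsetᵇ-complete (pair a b) W (λ i hi → both (∧-true (lookup W a) _ h) (∈pair a b i hi)))
  where
  both : ∀ {i} → lookup W a ≡ true × lookup W b ≡ true → i ≡ a ⊎ i ≡ b → lookup W i ≡ true
  both (wa , _) (inj₁ refl) = wa
  both (_ , wb) (inj₂ refl) = wb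

fullᵇ-size : ∀ {n} (G : Subset n) → fullᵇ G ≡ true → ∣ G ∣ ≡ n
fullᵇ-size [] h = refl
fullᵇ-size (true ∷ G) h = cong suc (fullᵇ-size G h)

fullᵇ-lookup : ∀ {n} (W : Subset n) → fullᵇ W ≡ true → ∀ i → lookup W i ≡ true
fullᵇ-lookup (true ∷ W) h zero = refl
fullᵇ-lookup (true ∷ W) h (suc i) = fullᵇ-lookup W h i

fullᵇ-missing : ∀ {n} (W : Subset n) → fullᵇ W ≡ false → Σ (Fin n) λ c → lookup W c ≡ false
fullᵇ-missing (true ∷ W) h with fullᵇ-missing W h
... | c , e = suc c , e
fullᵇ-missing (false ∷ W) h = zero , refl

edge-sym : ∀ {n} (Δ : Complex n) (W : Subset n) → Symmetric (edgeᵇ Δ W)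
edge-sym Δ W u v h with ∧-true (lookup W u) _ h
... | wu , h' with ∧-true (lookup W v) _ h'
... | wv , huv = ∧-intro wv (∧-intro wu (trans (cong Δ (pair-comm v u)) huv))

walk-in-W : ∀ {n} (Δ : Complex n) (W : Subset n) {a b} → lookup W a ≡ true →
  Path (edgeᵇ Δ W) a b → lookup W b ≡ true
walk-in-W Δ W w here = w
walk-in-W Δ W {a} w (step e p) = walk-in-W Δ W (proj₁ (∧-true _ _ (proj₂ (∧-true (lookup W a) _ e)))) p

reach-equiv : ∀ {n} (Δ : Complex n) (W : Subset n) → IsEquivOn (lookup W) (Reach Δ W)
reach-equiv Δ W = record
  { refl-on = λ a _ → reach-complete Δ W a a here
  ; sym-on = λ a b _ h → reach-complete Δ W b a (reverseₚ (edge-sym Δ W) (reach-sound Δ W a b h))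
  ; trans-on = λ a b c _ h₁ h₂ →
      reach-complete Δ W a c (reach-sound Δ W a b h₁ ++ₚ reach-sound Δ W b c h₂)
  ; closed-on = λ a b w h → walk-in-W Δ W w (reach-sound Δ W a b h)
  }

nc-walk-cong : ∀ {n} (Δ₁ Δ₂ : Complex n) (W : Subset n) →
  (∀ u v → lookup W u ≡ true → Path (edgeᵇ Δ₁ W) u v → Path (edgeᵇ Δ₂ W) u v) →
  (∀ u v → lookup W u ≡ true → Path (edgeᵇ Δ₂ W) u v → Path (edgeᵇ Δ₁ W) u v) →
  nc Δ₁ W ≡ nc Δ₂ W
nc-walk-cong Δ₁ Δ₂ W to from =
  trans (nc≡classes Δ₁ W) (trans (classes-cong (lookup W) _ _ same) (sym (nc≡classes Δ₂ W)))
  where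
  same : ∀ v → lookup W v ≡ true → ∀ u → Reach Δ₁ W v u ≡ Reach Δ₂ W v u
  same v w u = bool-iff (λ r → reach-complete Δ₂ W v u (to v u w (reach-sound Δ₁ W v u r)))
                        (λ r → reach-complete Δ₁ W v u (from v u w (reach-sound Δ₂ W v u r)))

nc-edge-cong : ∀ {n} (Δ₁ Δ₂ : Complex n) (W : Subset n) →
  (∀ u v → edgeᵇ Δ₁ W u v ≡ edgeᵇ Δ₂ W u v) → nc Δ₁ W ≡ nc Δ₂ W
nc-edge-cong Δ₁ Δ₂ W h = nc-walk-cong Δ₁ Δ₂ W
  (λ u v _ → mapₚ (λ z → z) (λ x y e → trans (sym (h x y)) e))
  (λ u v _ → mapₚ (λ z → z) (λ x y e → trans (h x y) e))

nc-complete : ∀ {n} (Δ : Complex n) (W : Subset n) →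
  (∀ u v → u ≢ v → Δ (pair u v) ≡ true) → nc Δ W ≡ ι (anyFin (lookup W))
nc-complete {n} Δ W all-edges =
  trans (nc≡classes Δ W) (trans (classes-cong (lookup W) _ R one-class) count-classes)
  where
  R : Fin n → Fin n → Bool
  R v u = lookup W u
  one-class : ∀ v → lookup W v ≡ true → ∀ u → Reach Δ W v u ≡ R v u
  one-class v w u = bool-iff (λ r → walk-in-W Δ W w (reach-sound Δ W v u r))
                              (λ wu → reach-complete Δ W v u (walk wu))
    where
    walk : lookup W u ≡ true → Path (edgeᵇ Δ W) v u
    walk wu with v ≟ u
    ... | yes refl = here
    ... | no ne = step (∧-intro w (∧-intro wu (all-edges v u ne))) here
  R-equiv : IsEquivOn (lookup W) R
  R-equiv = record { refl-on = λ a w → w ; sym-on = λ a b wa _ → wa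
                   ; trans-on = λ a b c _ _ h → h ; closed-on = λ a b _ h → h }
  open LeastElements (lookup W) R R-equiv
  count-classes : classes (lookup W) R ≡ ι (anyFin (lookup W))
  count-classes with anyFin (lookup W) in e
  ... | false = count-none _ none
    where
    none : ∀ i → isLeast (lookup W) R i ≡ false
    none i with lookup W i in e'
    ... | false = refl
    ... | true = ⊥-elim (false≢true (trans (sym e) (anyFin-intro _ i e')))
  ... | true with anyFin-elim _ e
  ... | a , wa with least-of a wa
  ... | m , hm , _ = count-unique _ m hm (λ i hi → least-unique i m hi hm (least-in m hm))

remove : ∀ {n} → Complex n → Subset n → Complex n
remove Δ F G = Δ G ∧ not (eqᵇ G F)

edge-remove-⊆ : ∀ {n} (Δ : Complex n) F W u v → edgeᵇ (remove Δ F) W u v ≡ true → edgeᵇ Δ W u v ≡ true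
edge-remove-⊆ Δ F W u v h with ∧-true (lookup W u) _ h
... | wu , h' with ∧-true (lookup W v) _ h'
... | wv , huv = ∧-intro wu (∧-intro wv (proj₁ (∧-true (Δ (pair u v)) _ huv)))

edge-remove-cases : ∀ {n} (Δ : Complex n) F W u v → edgeᵇ Δ W u v ≡ true →
  edgeᵇ (remove Δ F) W u v ≡ true ⊎ (lookup W u ≡ true × lookup W v ≡ true × pair u v ≡ F)
edge-remove-cases Δ F W u v h with ∧-true (lookup W u) _ h
... | wu , h' with ∧-true (lookup W v) _ h'
... | wv , huv with eqᵇ (pair u v) F in e
... | false = inj₁ (∧-intro wu (∧-intro wv (∧-intro huv refl)))
... | true = inj₂ (wu , wv , eqᵇ⇒≡ _ F e)

-- A cone over a graph: vertex 0 is added, adjacent (when present, x) to the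
-- vertices in A; old vertices keep the edges E₀.
module Cone {n} (E₀ : Fin n → Fin n → Bool) (x : Bool) (A : Fin n → Bool)
  (E* : Fin (suc n) → Fin (suc n) → Bool)
  (old-edges : ∀ i j → E* (suc i) (suc j) ≡ E₀ i j)
  (apex-out : ∀ j → E* zero (suc j) ≡ x ∧ A j)
  (apex-in : ∀ j → E* (suc j) zero ≡ x ∧ A j) where

  lift₀ : ∀ {i j} → Path E₀ i j → Path E* (suc i) (suc j)
  lift₀ = mapₚ suc (λ a b e → trans (old-edges a b) e)

  unlift₀ : x ≡ false → ∀ {i y} → Path E* (suc i) y → Σ (Fin n) λ j → y ≡ suc j × Path E₀ i j
  unlift₀ x≡false {i} here = i , refl , here
  unlift₀ x≡false {i} (step {y = zero} e p) =
    ⊥-elim (false≢true (trans (sym (trans (apex-in i) (cong (_∧ A i) x≡false))) e))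
  unlift₀ x≡false {i} (step {y = suc k} e p) with unlift₀ x≡false p
  ... | j , refl , q = j , refl , step (trans (sym (old-edges i k)) e) q

  -- Walks through the apex become walks inside A, and
  -- conversely an extra edge inside A is a detour through the apex.
  module WithApex (E : Fin n → Fin n → Bool) (x≡true : x ≡ true)
    (E₀⊆E : ∀ i j → E₀ i j ≡ true → E i j ≡ true)
    (extra-in-A : ∀ i j → E i j ≡ true → E₀ i j ≡ true ⊎ (A i ≡ true × A j ≡ true))
    (A-clique : ∀ a b → A a ≡ true → A b ≡ true → Path E a b) where

    -- what a walk in E* between two vertices yields in E
    Shadow : Fin (suc n) → Fin (suc n) → Set
    Shadow (suc i) (suc j) = Path E i j
    Shadow (suc i) zero = Σ (Fin n) λ a → A a ≡ true × Path E i a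
    Shadow zero (suc j) = Σ (Fin n) λ a → A a ≡ true × Path E a j
    Shadow zero zero = ⊤

    apex-out-A : ∀ j → E* zero (suc j) ≡ true → A j ≡ true
    apex-out-A j e = trans (sym (cong (_∧ A j) x≡true)) (trans (sym (apex-out j)) e)

    apex-in-A : ∀ j → E* (suc j) zero ≡ true → A j ≡ true
    apex-in-A j e = trans (sym (cong (_∧ A j) x≡true)) (trans (sym (apex-in j)) e)

    old-step : ∀ i k → E* (suc i) (suc k) ≡ true → E i k ≡ true
    old-step i k e = E₀⊆E i k (trans (sym (old-edges i k)) e)

    shadow : ∀ {u y} → Path E* u y → Shadow u y
    shadow {zero} {zero} here = tt
    shadow {suc i} {suc i} here = here
    shadow {suc i} {zero} (step {y = suc k} e p) =
      let (a , ha , q) = shadow p in a , ha , step (old-step i k e) q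
    shadow {suc i} {suc j} (step {y = suc k} e p) = step (old-step i k e) (shadow p)
    shadow {suc i} {zero} (step {y = zero} e p) = i , apex-in-A i e , here
    shadow {suc i} {suc j} (step {y = zero} e p) =
      let (a , ha , q) = shadow p in A-clique i a (apex-in-A i e) ha ++ₚ q
    shadow {zero} {zero} (step e p) = tt
    shadow {zero} {suc j} (step {y = zero} e p) = shadow p
    shadow {zero} {suc j} (step {y = suc k} e p) = k , apex-out-A k e , shadow p

    lift : ∀ {i j} → Path E i j → Path E* (suc i) (suc j)
    lift here = here
    lift {i} (step {y = k} e p) with extra-in-A i k e
    ... | inj₁ e₀ = step (trans (old-edges i k) e₀) (lift p)
    ... | inj₂ (ai , ak) = step (trans (apex-in i) (trans (cong (_∧ A i) x≡true) ai))
                             (step (trans (apex-out k) (trans (cong (_∧ A k) x≡true) ak)) (lift p))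

    lift-to-apex : ∀ {i} a → A a ≡ true → Path E i a → Path E* (suc i) zero
    lift-to-apex a ha p = snocₚ (lift p) (trans (apex-in a) (trans (cong (_∧ A a) x≡true) ha))

-- One stacking step on a facet F (|F| ≥ 2) with new vertex 0, seen on the
-- vertex set  x ∷ W'  (x says whether the new vertex is present).
module StackStep {n} (Δ : Complex n) (F : Subset n) (F2 : 2 ≤ ∣ F ∣) (W' : Subset n) where
  Δ' = stackStep Δ F
  Δ₀ = remove Δ F

  A : Fin n → Bool
  A j = lookup W' j ∧ lookup F j

  apex-edge : ∀ j → Δ' (true ∷ ⁅ j ⁆) ≡ lookup F j
  apex-edge j = trans (cong₂ _∧_ (subsetᵇ-⁅⁆ j F) (cong not (eqᵇ-size ⁅ j ⁆ F ne)))
                      (BoolP.∧-identityʳ _)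
    where
    ne : ∣ ⁅ j ⁆ ∣ ≢ ∣ F ∣
    ne e = NP.<-irrefl (trans (sym (∣⁅x⁆∣≡1 j)) e) (NP.<-≤-trans (s≤s (s≤s z≤n)) F2)

  module _ (x : Bool) where
    E* = edgeᵇ Δ' (x ∷ W')

    apex-out : ∀ j → E* zero (suc j) ≡ x ∧ A j
    apex-out j = cong (λ z → x ∧ (lookup W' j ∧ z))
      (trans (cong (λ z → Δ' (true ∷ z)) (∅∪ ⁅ j ⁆)) (apex-edge j))

    apex-in : ∀ j → E* (suc j) zero ≡ x ∧ A j
    apex-in j = trans (cong (λ z → lookup W' j ∧ (x ∧ z))
                        (trans (cong (λ z → Δ' (true ∷ z)) (∪∅ ⁅ j ⁆)) (apex-edge j)))
                      (swap (lookup W' j) x (lookup F j))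
      where
      swap : ∀ a b c → (a ∧ (b ∧ c)) ≡ (b ∧ (a ∧ c))
      swap true b c = refl
      swap false true c = refl
      swap false false c = refl

    module C = Cone (edgeᵇ Δ₀ W') x A E* (λ i j → refl) apex-out apex-in

  nc-without-apex : nc Δ' (false ∷ W') ≡ nc Δ₀ W'
  nc-without-apex = trans (nc≡classes Δ' (false ∷ W'))
    (trans (ExtendByZero.classes-extend false (lookup W') (Reach Δ₀ W') (Reach Δ' (false ∷ W'))
              (λ _ → false) old never)
    (trans (count-cong _ (isLeast (lookup W') (Reach Δ₀ W')) (λ i → BoolP.∧-identityʳ _))
           (sym (nc≡classes Δ₀ W'))))
    where
    old : ∀ i j → lookup W' i ≡ true → Reach Δ' (false ∷ W') (suc i) (suc j) ≡ Reach Δ₀ W' i j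
    old i j _ = bool-iff
      (λ h → let (j' , e , p) = C.unlift₀ false refl (reach-sound Δ' (false ∷ W') (suc i) (suc j) h)
             in reach-complete Δ₀ W' i j (subst (Path (edgeᵇ Δ₀ W') i) (FP.suc-injective (sym e)) p))
      (λ h → reach-complete Δ' (false ∷ W') (suc i) (suc j) (C.lift₀ false (reach-sound Δ₀ W' i j h)))
    never : ∀ i → lookup W' i ≡ true → Reach Δ' (false ∷ W') (suc i) zero ≡ false
    never i _ with Reach Δ' (false ∷ W') (suc i) zero in e
    ... | false = refl
    ... | true with C.unlift₀ false refl (reach-sound Δ' (false ∷ W') (suc i) zero e)
    ... | (_ , () , _)

  -- With the new vertex, and when all pairs in F are edges of Δ: the new
  -- vertex merges the components meeting F, adding one component iff W' ∩ F = ∅.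
  module _ (F-edges : ∀ a b → lookup F a ≡ true → lookup F b ≡ true → a ≢ b → Δ (pair a b) ≡ true) where
    E = edgeᵇ Δ W'

    A-clique : ∀ a b → A a ≡ true → A b ≡ true → Path E a b
    A-clique a b ha hb with a ≟ b
    ... | yes refl = here
    ... | no ne with ∧-true _ _ ha | ∧-true _ _ hb
    ... | wa , fa | wb , fb = step (∧-intro wa (∧-intro wb (F-edges a b fa fb ne))) here

    extra-in-A : ∀ i j → E i j ≡ true → edgeᵇ Δ₀ W' i j ≡ true ⊎ (A i ≡ true × A j ≡ true)
    extra-in-A i j h with edge-remove-cases Δ F W' i j h
    ... | inj₁ e = inj₁ e
    ... | inj₂ (wi , wj , pe) = inj₂ (∧-intro wi (subst (λ z → lookup z i ≡ true) pe (∈pairˡ i j)) ,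
                                      ∧-intro wj (subst (λ z → lookup z j ≡ true) pe (∈pairʳ i j)))

    module CA = C.WithApex true E refl (edge-remove-⊆ Δ F W') extra-in-A A-clique

    meetsA : Fin n → Bool
    meetsA i = anyFin (λ a → A a ∧ Reach Δ W' i a)

    nc-with-apex : nc Δ' (true ∷ W') +ℕ ι (anyFin A) ≡ suc (nc Δ W')
    nc-with-apex = trans (cong (_+ℕ ι (anyFin A)) (trans (nc≡classes Δ' (true ∷ W'))
        (ExtendByZero.classes-extend true (lookup W') (Reach Δ W') (Reach Δ' (true ∷ W')) meetsA old to-apex)))
      (cong suc (trans (ClassesMeetingClique.classes-meeting-clique (lookup W') (Reach Δ W') (reach-equiv Δ W') A
                          (λ a h → proj₁ (∧-true _ _ h))
                          (λ a b ha hb → reach-complete Δ W' a b (A-clique a b ha hb)))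
               (sym (nc≡classes Δ W'))))
      where
      old : ∀ i j → lookup W' i ≡ true → Reach Δ' (true ∷ W') (suc i) (suc j) ≡ Reach Δ W' i j
      old i j _ = bool-iff
        (λ h → reach-complete Δ W' i j (CA.shadow (reach-sound Δ' (true ∷ W') (suc i) (suc j) h)))
        (λ h → reach-complete Δ' (true ∷ W') (suc i) (suc j) (CA.lift (reach-sound Δ W' i j h)))
      to-apex : ∀ i → lookup W' i ≡ true → Reach Δ' (true ∷ W') (suc i) zero ≡ meetsA i
      to-apex i _ = bool-iff
        (λ h → let (a , ha , p) = CA.shadow (reach-sound Δ' (true ∷ W') (suc i) zero h)
               in anyFin-intro _ a (∧-intro ha (reach-complete Δ W' i a p)))
        (λ h → let (a , h') = anyFin-elim _ h
                   (ha , r) = ∧-true _ _ h'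
               in reach-complete Δ' (true ∷ W') (suc i) zero (CA.lift-to-apex a ha (reach-sound Δ W' i a r)))

sumAll : ∀ {n} → (Subset n → ℤ) → ℤ
sumAll {zero} f = f []
sumAll {suc n} f = sumAll (λ W → f (true ∷ W)) + sumAll (λ W → f (false ∷ W))

when : Bool → ℤ → ℤ
when true z = z
when false z = + 0

sumSize : ∀ {n} → ℕ → (Subset n → ℤ) → ℤ
sumSize k f = sumAll (λ W → when (∣ W ∣ ≡ᵇ k) (f W))

sumAll-cong : ∀ {n} (f g : Subset n → ℤ) → (∀ W → f W ≡ g W) → sumAll f ≡ sumAll g
sumAll-cong {zero} f g h = h []
sumAll-cong {suc n} f g h =
  cong₂ _+_ (sumAll-cong _ _ (λ W → h (true ∷ W))) (sumAll-cong _ _ (λ W → h (false ∷ W)))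

sumAll-zero : ∀ {n} (f : Subset n → ℤ) → (∀ W → f W ≡ + 0) → sumAll f ≡ + 0
sumAll-zero {zero} f h = h []
sumAll-zero {suc n} f h = cong₂ _+_ (sumAll-zero _ (λ W → h (true ∷ W))) (sumAll-zero _ (λ W → h (false ∷ W)))

sumAll-+ : ∀ {n} (f g : Subset n → ℤ) → sumAll (λ W → f W + g W) ≡ sumAll f + sumAll g
sumAll-+ {zero} f g = refl
sumAll-+ {suc n} f g =
  trans (cong₂ _+_ (sumAll-+ (λ W → f (true ∷ W)) _) (sumAll-+ (λ W → f (false ∷ W)) _))
    (interchange (sumAll (λ W → f (true ∷ W))) (sumAll (λ W → g (true ∷ W)))
                 (sumAll (λ W → f (false ∷ W))) _)
  where
  interchange : ∀ a b c d → (a + b) + (c + d) ≡ (a + c) + (b + d)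
  interchange = solve-∀

sumAll-neg : ∀ {n} (f : Subset n → ℤ) → sumAll (λ W → - f W) ≡ - sumAll f
sumAll-neg {zero} f = refl
sumAll-neg {suc n} f =
  trans (cong₂ _+_ (sumAll-neg (λ W → f (true ∷ W))) (sumAll-neg (λ W → f (false ∷ W))))
    (sym (ℤP.neg-distrib-+ (sumAll (λ W → f (true ∷ W))) _))

sumSize-cong : ∀ {n} k (f g : Subset n → ℤ) → (∀ W → f W ≡ g W) → sumSize k f ≡ sumSize k g
sumSize-cong k f g h = sumAll-cong _ _ (λ W → cong (when (∣ W ∣ ≡ᵇ k)) (h W))

sumSize-+ : ∀ {n} k (f g : Subset n → ℤ) → sumSize k (λ W → f W + g W) ≡ sumSize k f + sumSize k g
sumSize-+ {n} k f g = trans (sumAll-cong _ _ (λ W → when-+ (∣ W ∣ ≡ᵇ k) (f W) (g W))) (sumAll-+ {n} _ _)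
  where
  when-+ : ∀ c x y → when c (x + y) ≡ when c x + when c y
  when-+ true x y = refl
  when-+ false x y = refl

sumSize-neg : ∀ {n} k (f : Subset n → ℤ) → sumSize k (λ W → - f W) ≡ - sumSize k f
sumSize-neg {n} k f = trans (sumAll-cong _ _ (λ W → when-neg (∣ W ∣ ≡ᵇ k) (f W))) (sumAll-neg {n} _)
  where
  when-neg : ∀ c x → when c (- x) ≡ - when c x
  when-neg true x = refl
  when-neg false x = refl

sumAll-when-zero : ∀ {n} (c : Subset n → Bool) (f : Subset n → ℤ) → (∀ W → f W ≡ + 0) →
  sumAll (λ W → when (c W) (f W)) ≡ + 0
sumAll-when-zero c f h = sumAll-zero _ (λ W → vanish (c W) W)
  where
  vanish : ∀ c W → when c (f W) ≡ + 0
  vanish true W = h W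
  vanish false W = refl

sumℤ-++ : (xs ys : List.List ℤ) → sumℤ (xs List.++ ys) ≡ sumℤ xs + sumℤ ys
sumℤ-++ List.[] ys = sym (ℤP.+-identityˡ _)
sumℤ-++ (x List.∷ xs) ys = trans (cong (λ s → x + s) (sumℤ-++ xs ys)) (sym (ℤP.+-assoc x _ _))

sumℤ-all : ∀ {n} (h : Subset n → ℤ) → sumℤ (List.map h (allSubsets n)) ≡ sumAll h
sumℤ-all {zero} h = ℤP.+-identityʳ _
sumℤ-all {suc n} h =
  trans (cong sumℤ (ListP.map-++ h (List.map (true ∷_) (allSubsets n)) _))
  (trans (sumℤ-++ (List.map h (List.map (true ∷_) (allSubsets n))) _)
  (cong₂ _+_ (trans (cong sumℤ (sym (ListP.map-∘ (allSubsets n)))) (sumℤ-all {n} _))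
             (trans (cong sumℤ (sym (ListP.map-∘ (allSubsets n)))) (sumℤ-all {n} _))))

sumℤ-filter : ∀ {A : Set} (p : A → Bool) (g : A → ℤ) (xs : List.List A) →
  sumℤ (List.map g (List.filter (λ x → T? (p x)) xs)) ≡ sumℤ (List.map (λ x → when (p x) (g x)) xs)
sumℤ-filter p g List.[] = refl
sumℤ-filter p g (x List.∷ xs) with p x
... | true = cong (λ s → g x + s) (sumℤ-filter p g xs)
... | false = trans (sumℤ-filter p g xs) (sym (ℤP.+-identityˡ _))

b-as-sum : ∀ {n} k (Δ : Complex n) → b k Δ ≡ sumSize k (λ W → + nc Δ W - + 1)
b-as-sum {n} k Δ = trans (sumℤ-filter (λ W → ∣ W ∣ ≡ᵇ k) (λ W → + nc Δ W - + 1) (allSubsets n))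
                         (sumℤ-all {n} _)

disjointᵇ : ∀ {n} → Subset n → Subset n → Bool
disjointᵇ W F = not (anyFin (λ j → lookup W j ∧ lookup F j))

count-disjoint : ∀ {n} (F : Subset n) k → sumSize k (λ W → + ι (disjointᵇ W F)) ≡ + ((n ∸ ∣ F ∣) C k)
count-disjoint {zero} [] zero = refl
count-disjoint {zero} [] (suc k) = refl
count-disjoint {suc n} (true ∷ F) k =
  trans (cong₂ _+_ (sumAll-when-zero {n} _ _ (λ W → refl)) (count-disjoint F k)) (ℤP.+-identityˡ _)
count-disjoint {suc n} (false ∷ F) zero =
  trans (cong₂ _+_ (sumAll-zero {n} _ (λ W → refl)) (count-disjoint F zero)) (ℤP.+-identityˡ _)
count-disjoint {suc n} (false ∷ F) (suc k) =
  trans (cong₂ _+_ (count-disjoint F k) (count-disjoint F (suc k)))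
    (trans (sym (ℤP.pos-+ ((n ∸ ∣ F ∣) C k) _))
      (cong +_ (trans (NC.nCk+nC[k+1]≡[n+1]C[k+1] (n ∸ ∣ F ∣) k)
                      (cong (_C suc k) (sym (NP.+-∸-assoc 1 (∣p∣≤n F)))))))

-- C(m, j - f), or 0 when j < f: the number of j-subsets of Fin (m + f)
-- containing a fixed f-subset.
shiftedC : ℕ → ℕ → ℕ → ℕ
shiftedC m j zero = m C j
shiftedC m zero (suc f) = 0
shiftedC m (suc j) (suc f) = shiftedC m j f

shiftedC-zero : ∀ f m → shiftedC (suc m) zero f ≡ shiftedC m zero f
shiftedC-zero zero m = refl
shiftedC-zero (suc f) m = refl

shiftedC-pascal : ∀ f m j → shiftedC (suc m) (suc j) f ≡ shiftedC m j f +ℕ shiftedC m (suc j) f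
shiftedC-pascal zero m j = sym (NC.nCk+nC[k+1]≡[n+1]C[k+1] m j)
shiftedC-pascal (suc f) m zero = shiftedC-zero f m
shiftedC-pascal (suc f) m (suc j) = shiftedC-pascal f m j

count-supersets : ∀ {n} (F : Subset n) j →
  sumSize j (λ W → + ι (subsetᵇ F W)) ≡ + shiftedC (n ∸ ∣ F ∣) j ∣ F ∣
count-supersets {zero} [] zero = refl
count-supersets {zero} [] (suc j) = refl
count-supersets {suc n} (true ∷ F) zero =
  cong₂ _+_ (sumAll-zero {n} _ (λ W → refl)) (sumAll-when-zero {n} _ _ (λ W → refl))
count-supersets {suc n} (true ∷ F) (suc j) =
  trans (cong₂ _+_ (count-supersets F j) (sumAll-when-zero {n} _ _ (λ W → refl))) (ℤP.+-identityʳ _)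
count-supersets {suc n} (false ∷ F) zero =
  trans (cong₂ _+_ (sumAll-zero {n} _ (λ W → refl)) (count-supersets F zero))
    (trans (ℤP.+-identityˡ _)
      (cong +_ (trans (sym (shiftedC-zero ∣ F ∣ (n ∸ ∣ F ∣)))
                      (cong (λ z → shiftedC z 0 ∣ F ∣) (sym (NP.+-∸-assoc 1 (∣p∣≤n F)))))))
count-supersets {suc n} (false ∷ F) (suc j) =
  trans (cong₂ _+_ (count-supersets F j) (count-supersets F (suc j)))
    (trans (sym (ℤP.pos-+ (shiftedC (n ∸ ∣ F ∣) j ∣ F ∣) _))
      (cong +_ (trans (sym (shiftedC-pascal ∣ F ∣ (n ∸ ∣ F ∣) j))
                      (cong (λ z → shiftedC z (suc j) ∣ F ∣) (sym (NP.+-∸-assoc 1 (∣p∣≤n F)))))))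

count-full : ∀ {n} j → sumSize {n} j (λ W → + ι (fullᵇ W)) ≡ + ι (j ≡ᵇ n)
count-full {zero} zero = refl
count-full {zero} (suc j) = refl
count-full {suc n} zero = cong₂ _+_ (sumAll-zero {n} _ (λ W → refl)) (sumAll-when-zero {n} _ _ (λ W → refl))
count-full {suc n} (suc j) =
  trans (cong₂ _+_ (count-full {n} j) (sumAll-when-zero {n} _ _ (λ W → refl))) (ℤP.+-identityʳ _)

b-complete : ∀ {n} (Δ : Complex n) → (∀ u v → u ≢ v → Δ (pair u v) ≡ true) →
  ∀ k → b k Δ ≡ - (+ (0 C k))
b-complete {n} Δ all-edges k =
  begin
    b k Δ
  ≡⟨ b-as-sum k Δ ⟩
    sumSize {n} k (λ W → + nc Δ W - + 1)
  ≡⟨ sumSize-cong k _ _ term ⟩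
    sumSize {n} k (λ W → - + ι (disjointᵇ W 𝕍))
  ≡⟨ sumSize-neg {n} k _ ⟩
    - sumSize {n} k (λ W → + ι (disjointᵇ W 𝕍))
  ≡⟨ cong -_ (count-disjoint {n} 𝕍 k) ⟩
    - + ((n ∸ ∣ 𝕍 {n} ∣) C k)
  ≡⟨ cong (λ z → - + (z C k)) (trans (cong (n ∸_) (∣⊤∣≡n n)) (NP.n∸n≡0 n)) ⟩
    - (+ (0 C k))
  ∎
  where
  open ≡-Reasoning
  minus-one : ∀ a → + ι a - + 1 ≡ - (+ ι (not a))
  minus-one true = refl
  minus-one false = refl
  -- W is nonempty iff it is not disjoint from the whole vertex set
  term : ∀ W → + nc Δ W - + 1 ≡ - + ι (disjointᵇ W 𝕍)
  term W = trans (cong (λ z → + z - + 1) (nc-complete Δ W all-edges))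
    (trans (minus-one _) (cong (λ z → - + ι (not z))
      (anyFin-cong _ _ (λ j → sym (trans (cong (lookup W j ∧_) (lookup-𝕍 j)) (BoolP.∧-identityʳ _))))))

simplex-edges : ∀ d → 2 ≤ d → ∀ (u v : Fin (suc d)) → not (fullᵇ (pair u v)) ≡ true
simplex-edges d d≥2 u v with fullᵇ (pair u v) in e
... | false = refl
... | true = ⊥-elim (NP.<-irrefl (fullᵇ-size (pair u v) e)
                       (NP.≤-<-trans (∣pair∣≤2 u v) (s≤s d≥2)))

b-simplex : ∀ d → 2 ≤ d → ∀ k → b {suc d} k (λ G → not (fullᵇ G)) ≡ - (+ (0 C k))
b-simplex d d≥2 k = b-complete (λ G → not (fullᵇ G)) (λ u v _ → simplex-edges d d≥2 u v) k

stacked-size : ∀ {d n Δ} → Stacked d n Δ → suc d ≤ n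
stacked-size simplex = NP.≤-refl
stacked-size (stack s F _ _) = NP.m≤n⇒m≤1+n (stacked-size s)

-- The k-subsets of the new vertex
-- set containing the new vertex contribute b_{k-1}(Δ) + C(n - |F|, k - 1);
-- those avoiding it contribute the same as for Δ with F deleted.
module Recurrence {n} (Δ : Complex n) (F : Subset n) (F2 : 2 ≤ ∣ F ∣)
  (F-edges : ∀ a b → lookup F a ≡ true → lookup F b ≡ true → a ≢ b → Δ (pair a b) ≡ true) where
  Δ' = stackStep Δ F
  Δ₀ = remove Δ F
  module S (W : Subset n) = StackStep Δ F F2 W

  avoiding : ∀ k → sumSize k (λ W → + nc Δ' (false ∷ W) - + 1) ≡ sumSize k (λ W → + nc Δ₀ W - + 1)
  avoiding k = sumSize-cong k _ _ (λ W → cong (λ z → + z - + 1) (S.nc-without-apex W))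

  -- from  nc' + [W ∩ F ≠ ∅] = nc + 1
  shift : ∀ c c' a → c' +ℕ ι a ≡ suc c → + c' - + 1 ≡ (+ c - + 1) + + ι (not a)
  shift c c' true e rewrite NP.suc-injective (trans (NP.+-comm 1 c') e) = sym (ℤP.+-identityʳ _)
  shift c c' false e rewrite trans (sym (NP.+-identityʳ c')) e = reorder (+ c)
    where
    reorder : ∀ x → (+ 1 + x) - + 1 ≡ (x - + 1) + + 1
    reorder = solve-∀

  containing : ∀ k → sumSize k (λ W → + nc Δ' (true ∷ W) - + 1) ≡ b k Δ + + ((n ∸ ∣ F ∣) C k)
  containing k =
    trans (sumSize-cong k _ _ (λ W → shift (nc Δ W) (nc Δ' (true ∷ W)) _ (S.nc-with-apex W F-edges)))
      (trans (sumSize-+ {n} k _ _) (cong₂ _+_ (sym (b-as-sum k Δ)) (count-disjoint F k)))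

  b-zero : b 0 Δ' ≡ sumSize 0 (λ W → + nc Δ₀ W - + 1)
  b-zero = trans (b-as-sum 0 Δ')
    (trans (cong₂ _+_ (sumAll-zero {n} _ (λ W → refl)) (avoiding 0)) (ℤP.+-identityˡ _))

  b-suc : ∀ k → b (suc k) Δ' ≡ (b k Δ + + ((n ∸ ∣ F ∣) C k)) + sumSize (suc k) (λ W → + nc Δ₀ W - + 1)
  b-suc k = trans (b-as-sum (suc k) Δ') (cong₂ _+_ (containing k) (avoiding (suc k)))

-- Dimension d ≥ 3.  Every pair of vertices of a face is an edge, and the
-- facet F deleted by a stacking step has ≥ 3 vertices, so it is not an edge:
-- deleting it changes no nc, and the recurrence closes on b itself.

PairsAreEdges : ∀ {n} → Complex n → Set
PairsAreEdges {n} Δ = ∀ (G : Subset n) a b → Δ G ≡ true →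
  lookup G a ≡ true → lookup G b ≡ true → Δ (pair a b) ≡ true

pairs-are-edges-step : ∀ {n} (Δ : Complex n) (F : Subset n) → 3 ≤ ∣ F ∣ → Δ F ≡ true →
  PairsAreEdges Δ → PairsAreEdges (stackStep Δ F)
pairs-are-edges-step {n} Δ F F3 hF pairs = go
  where
  small : ∀ X → ∣ X ∣ ≤ 2 → eqᵇ X F ≡ false
  small X sz = eqᵇ-size X F (λ e → NP.<-irrefl e (NP.≤-<-trans sz (NP.<-≤-trans (NP.n<1+n 2) F3)))

  new-edge : ∀ X → X ⊆ˡ F → ∣ X ∣ ≤ 2 → stackStep Δ F (true ∷ X) ≡ true
  new-edge X X⊆F sz = ∧-intro (subsetᵇ-complete X F X⊆F) (cong not (small X sz))

  old-edge : ∀ a b → Δ (pair a b) ≡ true → stackStep Δ F (false ∷ pair a b) ≡ true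
  old-edge a b h = ∧-intro h (cong not (small (pair a b) (∣pair∣≤2 a b)))

  ∣∪∣≤2 : ∀ (p q : Subset n) → ∣ p ∣ ≤ 1 → ∣ q ∣ ≤ 1 → ∣ p ∪ q ∣ ≤ 2
  ∣∪∣≤2 p q h₁ h₂ = NP.≤-trans (∣∪∣≤ p q) (NP.+-mono-≤ h₁ h₂)

  ∣∅∣≤1 : ∣ ∅ {n} ∣ ≤ 1
  ∣∅∣≤1 = NP.≤-trans (NP.≤-reflexive (∣⊥∣≡0 n)) z≤n

  ∣⁅⁆∣≤1 : ∀ (j : Fin n) → ∣ ⁅ j ⁆ ∣ ≤ 1
  ∣⁅⁆∣≤1 j = NP.≤-reflexive (∣⁅x⁆∣≡1 j)

  ∪⊆ : ∀ (p q : Subset n) → p ⊆ˡ F → q ⊆ˡ F → (p ∪ q) ⊆ˡ F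
  ∪⊆ p q h₁ h₂ i h with ∨-true _ _ (trans (sym (lookup-∪ p q i)) h)
  ... | inj₁ x = h₁ i x
  ... | inj₂ x = h₂ i x

  ∅⊆ : ∅ ⊆ˡ F
  ∅⊆ i h = ⊥-elim (false≢true (trans (sym (lookup-∅ i)) h))

  ⁅⁆⊆ : ∀ j → lookup F j ≡ true → ⁅ j ⁆ ⊆ˡ F
  ⁅⁆⊆ j h i hi = subst (λ z → lookup F z ≡ true) (sym (∈⁅⁆⇒≡ j i hi)) h

  go : PairsAreEdges (stackStep Δ F)
  go (true ∷ G) zero zero hG _ _ = new-edge (∅ ∪ ∅) (∪⊆ ∅ ∅ ∅⊆ ∅⊆) (∣∪∣≤2 ∅ ∅ ∣∅∣≤1 ∣∅∣≤1)
  go (true ∷ G) zero (suc b) hG _ hb =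
    new-edge (∅ ∪ ⁅ b ⁆) (∪⊆ ∅ ⁅ b ⁆ ∅⊆ (⁅⁆⊆ b (G⊆F b hb))) (∣∪∣≤2 ∅ ⁅ b ⁆ ∣∅∣≤1 (∣⁅⁆∣≤1 b))
    where G⊆F = subsetᵇ-sound G F (proj₁ (∧-true _ _ hG))
  go (true ∷ G) (suc a) zero hG ha _ =
    new-edge (⁅ a ⁆ ∪ ∅) (∪⊆ ⁅ a ⁆ ∅ (⁅⁆⊆ a (G⊆F a ha)) ∅⊆) (∣∪∣≤2 ⁅ a ⁆ ∅ (∣⁅⁆∣≤1 a) ∣∅∣≤1)
    where G⊆F = subsetᵇ-sound G F (proj₁ (∧-true _ _ hG))
  go (true ∷ G) (suc a) (suc b) hG ha hb = old-edge a b (pairs F a b hF (G⊆F a ha) (G⊆F b hb))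
    where G⊆F = subsetᵇ-sound G F (proj₁ (∧-true _ _ hG))
  go (false ∷ G) (suc a) (suc b) hG ha hb = old-edge a b (pairs G a b (proj₁ (∧-true _ _ hG)) ha hb)

stacked-pairs-are-edges : ∀ {d n Δ} → 3 ≤ d → Stacked d n Δ → PairsAreEdges Δ
stacked-pairs-are-edges {d} d≥3 simplex G a b _ _ _ = simplex-edges d (NP.≤-trans (NP.n≤1+n 2) d≥3) a b
stacked-pairs-are-edges d≥3 (stack s F hF sz) =
  pairs-are-edges-step _ F (subst (3 ≤_) (sym sz) d≥3) hF (stacked-pairs-are-edges d≥3 s)

b-remove-large : ∀ {n} (Δ : Complex n) (F : Subset n) → 3 ≤ ∣ F ∣ →
  ∀ k → sumSize k (λ W → + nc (remove Δ F) W - + 1) ≡ b k Δ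
b-remove-large Δ F F3 k =
  trans (sumSize-cong k _ _ (λ W → cong (λ z → + z - + 1) (nc-edge-cong (remove Δ F) Δ W (same-edges W))))
        (sym (b-as-sum k Δ))
  where
  same-edges : ∀ W u v → edgeᵇ (remove Δ F) W u v ≡ edgeᵇ Δ W u v
  same-edges W u v = cong (λ z → lookup W u ∧ (lookup W v ∧ z))
    (trans (cong (λ z → Δ (pair u v) ∧ not z) (edge≢large u v F F3)) (BoolP.∧-identityʳ _))

high-step : ∀ m k → ((+ k - + 1) * + (m C k) + + (m C k)) + (+ suc k - + 1) * + (m C suc k)
                    ≡ (+ suc k - + 1) * + (suc m C suc k)
high-step m k =
  trans (regroup (+ k) (+ (m C k)) (+ (m C suc k)))
    (cong ((+ suc k - + 1) *_) (trans (sym (ℤP.pos-+ (m C k) _)) (cong +_ (NC.nCk+nC[k+1]≡[n+1]C[k+1] m k))))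
  where
  regroup : ∀ K c₁ c₂ → ((K - + 1) * c₁ + c₁) + ((+ 1 + K) - + 1) * c₂ ≡ ((+ 1 + K) - + 1) * (c₁ + c₂)
  regroup = solve-∀

b-stacked-high : ∀ {d n Δ} → 3 ≤ d → Stacked d n Δ → ∀ k → b k Δ ≡ (+ k - + 1) * + ((n ∸ d) C k)
b-stacked-high {d} d≥3 simplex k =
  trans (b-simplex d (NP.≤-trans (NP.n≤1+n 2) d≥3) k)
        (trans (base k) (cong (λ z → (+ k - + 1) * + (z C k)) (sym (NP.m+n∸n≡m 1 d))))
  where
  base : ∀ k → - (+ (0 C k)) ≡ (+ k - + 1) * + (1 C k)
  base zero = refl
  base (suc zero) = refl
  base (suc (suc k)) = sym (ℤP.*-zeroʳ (+ suc (suc k) - + 1))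
b-stacked-high {d} {suc n} d≥3 (stack {n} {Δ} s F hF sz) = formula
  where
  F3 : 3 ≤ ∣ F ∣
  F3 = subst (3 ≤_) (sym sz) d≥3
  module R = Recurrence Δ F (NP.≤-trans (NP.n≤1+n 2) F3)
                        (λ a b ha hb _ → stacked-pairs-are-edges d≥3 s F a b hF ha hb)
  IH = b-stacked-high d≥3 s
  n+1-d : suc n ∸ d ≡ suc (n ∸ d)
  n+1-d = NP.+-∸-assoc 1 (NP.≤-pred (NP.m≤n⇒m≤1+n (stacked-size s)))
  formula : ∀ k → b k (stackStep Δ F) ≡ (+ k - + 1) * + ((suc n ∸ d) C k)
  formula zero = trans R.b-zero (trans (b-remove-large Δ F F3 0) (IH 0))
  formula (suc k) rewrite n+1-d =
    begin
      b (suc k) (stackStep Δ F)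
    ≡⟨ R.b-suc k ⟩
      (b k Δ + + ((n ∸ ∣ F ∣) C k)) + sumSize (suc k) (λ W → + nc (remove Δ F) W - + 1)
    ≡⟨ cong (λ f → (b k Δ + + ((n ∸ f) C k)) + sumSize (suc k) (λ W → + nc (remove Δ F) W - + 1)) sz ⟩
      (b k Δ + + ((n ∸ d) C k)) + sumSize (suc k) (λ W → + nc (remove Δ F) W - + 1)
    ≡⟨ cong₂ (λ x y → (x + + ((n ∸ d) C k)) + y) (IH k) (trans (b-remove-large Δ F F3 (suc k)) (IH (suc k))) ⟩
      ((+ k - + 1) * + ((n ∸ d) C k) + + ((n ∸ d) C k)) + (+ suc k - + 1) * + ((n ∸ d) C suc k)
    ≡⟨ high-step (n ∸ d) k ⟩
      (+ suc k - + 1) * + (suc (n ∸ d) C suc k)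
    ∎
    where open ≡-Reasoning

-- Dimension 2.  Deleting an edge {a, b} of Δ from Δ_W.

SameEdge : ∀ {n} → Fin n → Fin n → Fin n → Fin n → Set
SameEdge u w p q = (u ≡ p × w ≡ q) ⊎ (u ≡ q × w ≡ p)

pair-injective : ∀ {n} (i k a b : Fin n) → a ≢ b → pair i k ≡ pair a b → SameEdge i k a b
pair-injective i k a b a≢b e
  with ∈pair a b i (subst (λ z → lookup z i ≡ true) e (∈pairˡ i k))
     | ∈pair a b k (subst (λ z → lookup z k ≡ true) e (∈pairʳ i k))
     | ∈pair i k a (subst (λ z → lookup z a ≡ true) (sym e) (∈pairˡ a b))
     | ∈pair i k b (subst (λ z → lookup z b ≡ true) (sym e) (∈pairʳ a b))
... | inj₁ i≡a | inj₂ k≡b | _ | _ = inj₁ (i≡a , k≡b)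
... | inj₂ i≡b | inj₁ k≡a | _ | _ = inj₂ (i≡b , k≡a)
... | inj₁ i≡a | inj₁ k≡a | _ | inj₁ b≡i = ⊥-elim (a≢b (trans (sym i≡a) (sym b≡i)))
... | inj₁ i≡a | inj₁ k≡a | _ | inj₂ b≡k = ⊥-elim (a≢b (trans (sym k≡a) (sym b≡k)))
... | inj₂ i≡b | inj₂ k≡b | inj₁ a≡i | _ = ⊥-elim (a≢b (trans a≡i i≡b))
... | inj₂ i≡b | inj₂ k≡b | inj₂ a≡k | _ = ⊥-elim (a≢b (trans a≡k k≡b))

eqᵇ-pair⇒same : ∀ {n} (u w a b : Fin n) → a ≢ b → eqᵇ (pair u w) (pair a b) ≡ true → SameEdge u w a b
eqᵇ-pair⇒same u w a b a≢b e = pair-injective u w a b a≢b (eqᵇ⇒≡ _ _ e)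

same⇒eqᵇ-pair : ∀ {n} (u w a b : Fin n) → SameEdge u w a b → eqᵇ (pair u w) (pair a b) ≡ true
same⇒eqᵇ-pair u w a b (inj₁ (refl , refl)) = eqᵇ-refl (pair u w)
same⇒eqᵇ-pair u w a b (inj₂ (refl , refl)) =
  subst (λ z → eqᵇ (pair u w) z ≡ true) (pair-comm u w) (eqᵇ-refl (pair u w))

module EdgeDeletion {n} (Δ : Complex n) (a b : Fin n) (a≢b : a ≢ b) (ab-edge : Δ (pair a b) ≡ true)
  (W : Subset n) where
  Δ₀ = remove Δ (pair a b)
  E = edgeᵇ Δ W
  E₀ = edgeᵇ Δ₀ W

  from₀ : ∀ {i j} → Path E₀ i j → Path E i j
  from₀ = mapₚ (λ z → z) (edge-remove-⊆ Δ (pair a b) W)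

  detour : ∀ {i j} → Path E i j →
    Path E₀ i j ⊎ (Path E₀ i a × Path E₀ b j) ⊎ (Path E₀ i b × Path E₀ a j)
  detour here = inj₁ here
  detour {i} (step {y = k} e p) with edge-remove-cases Δ (pair a b) W i k e | detour p
  ... | inj₁ e₀ | inj₁ q = inj₁ (step e₀ q)
  ... | inj₁ e₀ | inj₂ (inj₁ (q₁ , q₂)) = inj₂ (inj₁ (step e₀ q₁ , q₂))
  ... | inj₁ e₀ | inj₂ (inj₂ (q₁ , q₂)) = inj₂ (inj₂ (step e₀ q₁ , q₂))
  ... | inj₂ (_ , _ , same) | r with pair-injective i k a b a≢b same
  ... | inj₁ (refl , refl) with r
  ...   | inj₁ q = inj₂ (inj₁ (here , q))
  ...   | inj₂ (inj₁ (_ , q)) = inj₂ (inj₁ (here , q))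
  ...   | inj₂ (inj₂ (_ , q)) = inj₁ q
  detour {i} (step {y = k} e p) | inj₂ (_ , _ , same) | r | inj₂ (refl , refl) with r
  ...   | inj₁ q = inj₂ (inj₂ (here , q))
  ...   | inj₂ (inj₁ (_ , q)) = inj₁ q
  ...   | inj₂ (inj₂ (_ , q)) = inj₂ (inj₂ (here , q))

  -- If a or b is outside W, the deleted edge was not in Δ_W.
  nc-deletion-outside : lookup W a ∧ lookup W b ≡ false → nc Δ₀ W ≡ nc Δ W
  nc-deletion-outside outside =
    nc-edge-cong Δ₀ Δ W (λ u v → bool-iff (edge-remove-⊆ Δ (pair a b) W u v) (kept u v))
    where
    kept : ∀ u v → E u v ≡ true → E₀ u v ≡ true
    kept u v e with edge-remove-cases Δ (pair a b) W u v e
    ... | inj₁ e₀ = e₀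
    ... | inj₂ (wu , wv , same) with pair-injective u v a b a≢b same
    ... | inj₁ (refl , refl) = ⊥-elim (false≢true (trans (sym outside) (∧-intro wu wv)))
    ... | inj₂ (refl , refl) = ⊥-elim (false≢true (trans (sym outside) (∧-intro wv wu)))

  nc-deletion-joined : Path E₀ a b → nc Δ₀ W ≡ nc Δ W
  nc-deletion-joined a→b = nc-walk-cong Δ₀ Δ W (λ u v _ → from₀) (λ u v _ p → avoid (detour p))
    where
    b→a = reverseₚ (edge-sym Δ₀ W) a→b
    avoid : ∀ {u v} → _ → Path E₀ u v
    avoid (inj₁ q) = q
    avoid (inj₂ (inj₁ (q₁ , q₂))) = q₁ ++ₚ (a→b ++ₚ q₂)
    avoid (inj₂ (inj₂ (q₁ , q₂))) = q₁ ++ₚ (b→a ++ₚ q₂)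

  nc-deletion-bridge : lookup W a ≡ true → lookup W b ≡ true → ¬ Path E₀ a b → nc Δ₀ W ≡ suc (nc Δ W)
  nc-deletion-bridge wa wb no-path =
    trans (nc≡classes Δ₀ W)
      (trans (SplitOneClass.classes-split (lookup W) (Reach Δ₀ W) (Reach Δ W) (reach-equiv Δ₀ W) (reach-equiv Δ W)
                (λ i j _ r → reach-complete Δ W i j (from₀ (reach-sound Δ₀ W i j r))) a b wa wb
                (reach-complete Δ W a b (step (∧-intro wa (∧-intro wb ab-edge)) here)) ¬a~b splits)
             (cong suc (sym (nc≡classes Δ W))))
    where
    ¬a~b : Reach Δ₀ W a b ≡ false
    ¬a~b with Reach Δ₀ W a b in e
    ... | false = refl
    ... | true = ⊥-elim (no-path (reach-sound Δ₀ W a b e))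
    splits : ∀ i j → lookup W i ≡ true → Reach Δ W i j ≡ true →
      Reach Δ₀ W i j ≡ true ⊎ (Reach Δ₀ W i a ≡ true × Reach Δ₀ W b j ≡ true)
                            ⊎ (Reach Δ₀ W i b ≡ true × Reach Δ₀ W a j ≡ true)
    splits i j _ r with detour (reach-sound Δ W i j r)
    ... | inj₁ q = inj₁ (reach-complete Δ₀ W i j q)
    ... | inj₂ (inj₁ (q₁ , q₂)) = inj₂ (inj₁ (reach-complete Δ₀ W i a q₁ , reach-complete Δ₀ W b j q₂))
    ... | inj₂ (inj₂ (q₁ , q₂)) = inj₂ (inj₂ (reach-complete Δ₀ W i b q₁ , reach-complete Δ₀ W a j q₂))

-- The graph of a stacked polygon is a cycle.  We keep three properties of
-- cycles: every vertex has a neighbour, deleting one edge leaves its ends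
-- connected, and any two distinct edges form a cut (some 2-colouring
-- separates the ends of the first edge, and only these two edges join the
-- colours).

CutBy : ∀ {n} → Complex n → (Fin n → Bool) → Fin n → Fin n → Fin n → Fin n → Set
CutBy {n} Δ s p q r t = ∀ (u w : Fin n) → u ≢ w → Δ (pair u w) ≡ true → s u ≢ s w →
  SameEdge u w p q ⊎ SameEdge u w r t

TwoEdgeCut : ∀ {n} → Complex n → Fin n → Fin n → Fin n → Fin n → Set
TwoEdgeCut {n} Δ p q r t = Σ (Fin n → Bool) λ s → s p ≢ s q × CutBy Δ s p q r t

record CycleLike {n} (Δ : Complex n) : Set where
  field
    neighbour : ∀ c → Σ (Fin n) λ c' → c ≢ c' × Δ (pair c c') ≡ true
    reconnect : ∀ p q → p ≢ q → Δ (pair p q) ≡ true → Path (edgeᵇ (remove Δ (pair p q)) 𝕍) p q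
    two-edge-cut : ∀ p q r t → p ≢ q → r ≢ t → Δ (pair p q) ≡ true → Δ (pair r t) ≡ true →
      ¬ SameEdge p q r t → TwoEdgeCut Δ p q r t

same-swap : ∀ {n} {u w p q : Fin n} → SameEdge u w p q → SameEdge u w q p
same-swap (inj₁ (e₁ , e₂)) = inj₂ (e₁ , e₂)
same-swap (inj₂ (e₁ , e₂)) = inj₁ (e₁ , e₂)

same-sym : ∀ {n} {u w p q : Fin n} → SameEdge u w p q → SameEdge p q u w
same-sym (inj₁ (refl , refl)) = inj₁ (refl , refl)
same-sym (inj₂ (refl , refl)) = inj₂ (refl , refl)

same-suc : ∀ {n} {u w p q : Fin n} → SameEdge u w p q → SameEdge (suc u) (suc w) (suc p) (suc q)
same-suc (inj₁ (refl , refl)) = inj₁ (refl , refl)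
same-suc (inj₂ (refl , refl)) = inj₂ (refl , refl)

cut-flipˡ : ∀ {n} {Δ : Complex n} {p q r t} → TwoEdgeCut Δ p q r t → TwoEdgeCut Δ q p r t
cut-flipˡ (s , sep , cut) = s , (λ e → sep (sym e)) , λ u w ne h c → Sum.map same-swap (λ z → z) (cut u w ne h c)

cut-flipʳ : ∀ {n} {Δ : Complex n} {p q r t} → TwoEdgeCut Δ p q r t → TwoEdgeCut Δ p q t r
cut-flipʳ (s , sep , cut) = s , sep , λ u w ne h c → Sum.map (λ z → z) same-swap (cut u w ne h c)

module CycleConsequences {n} (Δ : Complex n) (cyc : CycleLike Δ) (a b : Fin n) (a≢b : a ≢ b)
  (ab-edge : Δ (pair a b) ≡ true) (W : Subset n) where
  open CycleLike cyc
  E₀ = edgeᵇ (remove Δ (pair a b)) W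

  joined-if-full : (∀ i → lookup W i ≡ true) → Path E₀ a b
  joined-if-full full = mapₚ (λ z → z) restrict (reconnect a b a≢b ab-edge)
    where
    restrict : ∀ u v → edgeᵇ (remove Δ (pair a b)) 𝕍 u v ≡ true → E₀ u v ≡ true
    restrict u v e = subst₂ (λ x y → x ∧ (y ∧ remove Δ (pair a b) (pair u v)) ≡ true)
      (trans (lookup-𝕍 u) (sym (full u))) (trans (lookup-𝕍 v) (sym (full v))) e

  -- A missing vertex c, with the edge {c, c'} at it, cuts the cycle together
  -- with {a, b}: the colouring is constant along every walk avoiding both.
  separated-if-missing : ∀ c → lookup W c ≡ false → lookup W a ≡ true → lookup W b ≡ true →
    ¬ Path E₀ a b
  separated-if-missing c wc wa wb p with neighbour c
  ... | c' , c≢c' , cc'-edge with two-edge-cut a b c c' a≢b c≢c' ab-edge cc'-edge not-same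
    where
    not-same : ¬ SameEdge a b c c'
    not-same (inj₁ (a≡c , _)) = false≢true (trans (sym wc) (subst (λ z → lookup W z ≡ true) a≡c wa))
    not-same (inj₂ (_ , b≡c)) = false≢true (trans (sym wc) (subst (λ z → lookup W z ≡ true) b≡c wb))
  ... | s , sab , cut = sab (constant p)
    where
    outside : ∀ {z} → z ≡ c → lookup W z ≡ true → ⊥
    outside refl wz = false≢true (trans (sym wc) wz)
    constant-edge : ∀ x y → E₀ x y ≡ true → s x ≡ s y
    constant-edge x y e with s x Bool.≟ s y
    ... | yes eq = eq
    ... | no ne with x ≟ y
    ... | yes refl = ⊥-elim (ne refl)
    ... | no x≢y with ∧-true (lookup W x) _ e
    ... | wx , e' with ∧-true (lookup W y) _ e'
    ... | wy , e'' with ∧-true (Δ (pair x y)) _ e''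
    ... | xy-edge , not-ab with cut x y x≢y xy-edge ne
    ... | inj₁ same = ⊥-elim (false≢true (trans (sym (not-true not-ab)) (same⇒eqᵇ-pair x y a b same)))
    ... | inj₂ (inj₁ (x≡c , _)) = ⊥-elim (outside x≡c wx)
    ... | inj₂ (inj₂ (_ , y≡c)) = ⊥-elim (outside y≡c wy)
    constant : ∀ {x y} → Path E₀ x y → s x ≡ s y
    constant here = refl
    constant (step e q) = trans (constant-edge _ _ e) (constant q)

triangle : Complex 3
triangle G = not (fullᵇ G)

triangle-neighbour : ∀ c → Σ (Fin 3) λ c' → c ≢ c' × triangle (pair c c') ≡ true
triangle-neighbour zero = suc zero , (λ ()) , refl
triangle-neighbour (suc zero) = zero , (λ ()) , refl
triangle-neighbour (suc (suc zero)) = zero , (λ ()) , refl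

triangle-reconnect : ∀ p q → p ≢ q → triangle (pair p q) ≡ true →
  Path (edgeᵇ (remove triangle (pair p q)) 𝕍) p q
triangle-reconnect zero zero p≢q _ = ⊥-elim (p≢q refl)
triangle-reconnect zero (suc zero) _ _ = step {y = suc (suc zero)} refl (step refl here)
triangle-reconnect zero (suc (suc zero)) _ _ = step {y = suc zero} refl (step refl here)
triangle-reconnect (suc zero) zero _ _ = step {y = suc (suc zero)} refl (step refl here)
triangle-reconnect (suc zero) (suc zero) p≢q _ = ⊥-elim (p≢q refl)
triangle-reconnect (suc zero) (suc (suc zero)) _ _ = step {y = zero} refl (step refl here)
triangle-reconnect (suc (suc zero)) zero _ _ = step {y = suc zero} refl (step refl here)
triangle-reconnect (suc (suc zero)) (suc zero) _ _ = step {y = zero} refl (step refl here)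
triangle-reconnect (suc (suc zero)) (suc (suc zero)) p≢q _ = ⊥-elim (p≢q refl)

-- Two distinct edges of the triangle share a vertex x; colouring x alone
-- cuts exactly these two edges.  This is a finite check, decided by evaluation.
shared-vertex : Fin 3 → Fin 3 → Fin 3 → Fin 3 → Fin 3
shared-vertex p q r t = if ⌊ p ≟ r ⌋ ∨ ⌊ p ≟ t ⌋ then p else q

colour-shared : Fin 3 → Fin 3 → Fin 3 → Fin 3 → Fin 3 → Bool
colour-shared p q r t u = ⌊ u ≟ shared-vertex p q r t ⌋

same-edge? : ∀ {n} (u w p q : Fin n) → Dec (SameEdge u w p q)
same-edge? u w p q = (u ≟ p ×-dec w ≟ q) ⊎-dec (u ≟ q ×-dec w ≟ p)

TriangleCuts : Set
TriangleCuts = ∀ p q r t → p ≢ q → r ≢ t → ¬ SameEdge p q r t →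
  (colour-shared p q r t p ≢ colour-shared p q r t q) × CutBy triangle (colour-shared p q r t) p q r t

triangle-cuts : TriangleCuts
triangle-cuts = toWitness {a? = decide} tt
  where
  decide : Dec TriangleCuts
  decide = FP.all? λ p → FP.all? λ q → FP.all? λ r → FP.all? λ t →
    ¬? (p ≟ q) →-dec ¬? (r ≟ t) →-dec ¬? (same-edge? p q r t) →-dec
    (¬? (colour-shared p q r t p Bool.≟ colour-shared p q r t q) ×-dec
     (FP.all? λ u → FP.all? λ w → ¬? (u ≟ w) →-dec (triangle (pair u w) Bool.≟ true) →-dec
       ¬? (colour-shared p q r t u Bool.≟ colour-shared p q r t w) →-dec
       (same-edge? u w p q ⊎-dec same-edge? u w r t)))

triangle-cycleLike : CycleLike triangle
triangle-cycleLike = record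
  { neighbour = triangle-neighbour
  ; reconnect = triangle-reconnect
  ; two-edge-cut = λ p q r t p≢q r≢t _ _ ne → let (sep , cut) = triangle-cuts p q r t p≢q r≢t ne
                                             in colour-shared p q r t , sep , cut
  }

-- Stacking a triangle onto an edge F = {a, b} of a cycle-like complex gives a
-- cycle-like complex: the new vertex 0 replaces the edge {a, b} by the path
-- a - 0 - b.
module CycleLikeStep {n} (Δ : Complex n) (a b : Fin n) (a≢b : a ≢ b) (ab-edge : Δ (pair a b) ≡ true)
  (F2 : 2 ≤ ∣ pair a b ∣) (cyc : CycleLike Δ) where
  open CycleLike cyc
  F = pair a b
  Δ' = stackStep Δ F

  InF : Fin n → Set
  InF y = y ≡ a ⊎ y ≡ b

  apex-edgeˡ : ∀ y → Δ' (pair zero (suc y)) ≡ lookup F y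
  apex-edgeˡ y = trans (cong (λ z → Δ' (true ∷ z)) (∅∪ ⁅ y ⁆)) (StackStep.apex-edge Δ F F2 𝕍 y)

  apex-edgeʳ : ∀ y → Δ' (pair (suc y) zero) ≡ lookup F y
  apex-edgeʳ y = trans (cong (λ z → Δ' (true ∷ z)) (∪∅ ⁅ y ⁆)) (StackStep.apex-edge Δ F F2 𝕍 y)

  data NewEdge : Fin (suc n) → Fin (suc n) → Set where
    old : ∀ {u w} → u ≢ w → Δ (pair u w) ≡ true → ¬ SameEdge u w a b → NewEdge (suc u) (suc w)
    from-apex : ∀ {y} → InF y → NewEdge zero (suc y)
    to-apex : ∀ {y} → InF y → NewEdge (suc y) zero

  view : ∀ u w → u ≢ w → Δ' (pair u w) ≡ true → NewEdge u w
  view zero zero ne h = ⊥-elim (ne refl)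
  view zero (suc y) ne h = from-apex (∈pair a b y (trans (sym (apex-edgeˡ y)) h))
  view (suc y) zero ne h = to-apex (∈pair a b y (trans (sym (apex-edgeʳ y)) h))
  view (suc u) (suc w) ne h with ∧-true (Δ (pair u w)) _ h
  ... | uw-edge , not-F = old (λ e → ne (cong suc e)) uw-edge
         (λ same → false≢true (trans (sym (not-true not-F)) (same⇒eqᵇ-pair u w a b same)))

  other-end : ∀ y → InF y → Σ (Fin n) λ y' → y' ≢ y × InF y' × SameEdge y y' a b
  other-end y (inj₁ refl) = b , (λ e → a≢b (sym e)) , inj₂ refl , inj₁ (refl , refl)
  other-end y (inj₂ refl) = a , a≢b , inj₁ refl , inj₂ (refl , refl)

  neighbour' : ∀ c → Σ (Fin (suc n)) λ c' → c ≢ c' × Δ' (pair c c') ≡ true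
  neighbour' zero = suc a , (λ ()) , trans (apex-edgeˡ a) (∈pairˡ a b)
  neighbour' (suc c) with neighbour c
  ... | c' , c≢c' , cc'-edge with eqᵇ (pair c c') F in e
  ... | false = suc c' , (λ x → c≢c' (FP.suc-injective x)) , ∧-intro cc'-edge (cong not e)
  ... | true = zero , (λ ()) ,
      trans (apex-edgeʳ c) (∈pair⁺ a b c (proj₁ (same-ends (eqᵇ-pair⇒same c c' a b a≢b e))))
    where
    same-ends : ∀ {u w} → SameEdge u w a b → InF u × InF w
    same-ends (inj₁ (x , y)) = inj₁ x , inj₂ y
    same-ends (inj₂ (x , y)) = inj₂ x , inj₁ y

  E'-without : Subset (suc n) → Fin (suc n) → Fin (suc n) → Bool
  E'-without X = edgeᵇ (remove Δ' X) 𝕍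

  mk-edge : ∀ X u w → Δ' (pair u w) ≡ true → eqᵇ (pair u w) X ≡ false → E'-without X u w ≡ true
  mk-edge X u w h e rewrite lookup-𝕍 u | lookup-𝕍 w | h | e = refl

  old-edge : ∀ X u v → edgeᵇ (remove Δ X) 𝕍 u v ≡ true → Δ (pair u v) ≡ true × eqᵇ (pair u v) X ≡ false
  old-edge X u v e rewrite lookup-𝕍 u | lookup-𝕍 v with ∧-true (Δ (pair u v)) _ e
  ... | h , not-X = h , not-true not-X

  around-F : ∀ y y' → InF y → SameEdge y y' a b → Path (edgeᵇ (remove Δ F) 𝕍) y' y
  around-F y y' (inj₁ refl) (inj₁ (_ , refl)) = reverseₚ (edge-sym (remove Δ F) 𝕍) (reconnect a b a≢b ab-edge)
  around-F y y' (inj₁ refl) (inj₂ (e , _)) = ⊥-elim (a≢b e)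
  around-F y y' (inj₂ refl) (inj₁ (e , _)) = ⊥-elim (a≢b (sym e))
  around-F y y' (inj₂ refl) (inj₂ (_ , refl)) = reconnect a b a≢b ab-edge

  -- an apex edge {0, y}: go to the other end y' of F and around the old cycle
  reconnect-apex : ∀ y → InF y → Path (E'-without (pair zero (suc y))) zero (suc y)
  reconnect-apex y hy with other-end y hy
  ... | y' , y'≢y , hy' , same = step first (mapₚ suc lift-edge (around-F y y' hy same))
    where
    X = pair zero (suc y)
    not-X : eqᵇ (pair zero (suc y')) X ≡ false
    not-X with eqᵇ (pair zero (suc y')) X in e
    ... | false = refl
    ... | true with eqᵇ-pair⇒same zero (suc y') zero (suc y) (λ ()) e
    ... | inj₁ (_ , e') = ⊥-elim (y'≢y (FP.suc-injective e'))
    ... | inj₂ (() , _)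
    first : E'-without X zero (suc y') ≡ true
    first = mk-edge X zero (suc y') (trans (apex-edgeˡ y') (∈pair⁺ a b y' hy')) not-X
    lift-edge : ∀ u v → edgeᵇ (remove Δ F) 𝕍 u v ≡ true → E'-without X (suc u) (suc v) ≡ true
    lift-edge u v e with old-edge F u v e
    ... | h , not-F = mk-edge X (suc u) (suc v) (∧-intro h (cong not not-F)) (BoolP.∧-zeroʳ _)

  -- an old edge {p', q'}: the old detour, with F replaced by a - 0 - b
  reconnect-old : ∀ p' q' → p' ≢ q' → Δ (pair p' q') ≡ true →
    Path (E'-without (pair (suc p') (suc q'))) (suc p') (suc q')
  reconnect-old p' q' p'≢q' h = bindₚ suc lift-edge (reconnect p' q' p'≢q' h)
    where
    X = pair (suc p') (suc q')
    through-apex : ∀ {u v} → InF u → InF v → Path (E'-without X) (suc u) (suc v)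
    through-apex {u} {v} hu hv =
      step {y = zero} (mk-edge X (suc u) zero (trans (apex-edgeʳ u) (∈pair⁺ a b u hu)) refl)
           (step (mk-edge X zero (suc v) (trans (apex-edgeˡ v) (∈pair⁺ a b v hv)) refl) here)
    lift-edge : ∀ u v → edgeᵇ (remove Δ (pair p' q')) 𝕍 u v ≡ true → Path (E'-without X) (suc u) (suc v)
    lift-edge u v e with old-edge (pair p' q') u v e
    ... | uv-edge , not-X with u ≟ v
    ... | yes refl = here
    ... | no u≢v with eqᵇ (pair u v) F in e'
    ... | false = step (mk-edge X (suc u) (suc v) (∧-intro uv-edge (cong not e')) not-X) here
    ... | true with eqᵇ-pair⇒same u v a b a≢b e'
    ... | inj₁ (refl , refl) = through-apex (inj₁ refl) (inj₂ refl)
    ... | inj₂ (refl , refl) = through-apex (inj₂ refl) (inj₁ refl)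

  reconnect' : ∀ p q → p ≢ q → Δ' (pair p q) ≡ true → Path (E'-without (pair p q)) p q
  reconnect' p q ne h with view p q ne h
  ... | from-apex {y} hy = reconnect-apex y hy
  ... | to-apex {y} hy = subst (λ X → Path (E'-without X) (suc y) zero) (pair-comm zero (suc y))
                           (reverseₚ (edge-sym (remove Δ' (pair zero (suc y))) 𝕍) (reconnect-apex y hy))
  ... | old {p'} {q'} p'≢q' h' _ = reconnect-old p' q' p'≢q' h'

  -- Two-edge cuts of Δ'.  The colouring of an old cut extends to the apex
  -- by the colour of a or of the other end of F; a cut by two apex edges
  -- colours the apex alone.
  extend : (Fin n → Bool) → Bool → Fin (suc n) → Bool
  extend s c zero = c
  extend s c (suc i) = s i

  end-of-F : ∀ {z y y'} → InF z → SameEdge y y' a b → z ≡ y ⊎ z ≡ y'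
  end-of-F (inj₁ refl) (inj₁ (refl , _)) = inj₁ refl
  end-of-F (inj₁ refl) (inj₂ (_ , refl)) = inj₂ refl
  end-of-F (inj₂ refl) (inj₁ (_ , refl)) = inj₂ refl
  end-of-F (inj₂ refl) (inj₂ (refl , _)) = inj₁ refl

  end-of-F' : ∀ {z y y'} → InF z → InF y → InF y' → y ≢ y' → z ≡ y ⊎ z ≡ y'
  end-of-F' (inj₁ refl) (inj₁ refl) _ _ = inj₁ refl
  end-of-F' (inj₁ refl) (inj₂ refl) (inj₁ refl) _ = inj₂ refl
  end-of-F' (inj₁ refl) (inj₂ refl) (inj₂ refl) ne = ⊥-elim (ne refl)
  end-of-F' (inj₂ refl) (inj₂ refl) _ _ = inj₁ refl
  end-of-F' (inj₂ refl) (inj₁ refl) (inj₂ refl) _ = inj₂ refl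
  end-of-F' (inj₂ refl) (inj₁ refl) (inj₁ refl) ne = ⊥-elim (ne refl)

  separates-F : ∀ (s : Fin n → Bool) {y y'} → s a ≢ s b → SameEdge y y' a b → s y' ≢ s y
  separates-F s sep (inj₁ (refl , refl)) e = sep (sym e)
  separates-F s sep (inj₂ (refl , refl)) e = sep e

  -- two old edges, both different from F: F is not cut, so 0 gets the colour of a
  cut-old-old : ∀ {p q r t} → p ≢ q → r ≢ t → Δ (pair p q) ≡ true → Δ (pair r t) ≡ true →
    ¬ SameEdge p q a b → ¬ SameEdge r t a b → ¬ SameEdge p q r t →
    TwoEdgeCut Δ' (suc p) (suc q) (suc r) (suc t)
  cut-old-old {p} {q} {r} {t} p≢q r≢t pq-edge rt-edge pq≠F rt≠F pq≠rt
    with two-edge-cut p q r t p≢q r≢t pq-edge rt-edge pq≠rt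
  ... | s , sep , cut = extend s (s a) , sep , cut'
    where
    F-uncut : s a ≢ s b → ⊥
    F-uncut c with cut a b a≢b ab-edge c
    ... | inj₁ same = pq≠F (same-sym same)
    ... | inj₂ same = rt≠F (same-sym same)
    cut' : CutBy Δ' (extend s (s a)) (suc p) (suc q) (suc r) (suc t)
    cut' u w ne h c with view u w ne h
    ... | old {u'} {w'} u'≢w' h' _ = Sum.map same-suc same-suc (cut u' w' u'≢w' h' c)
    ... | from-apex (inj₁ refl) = ⊥-elim (c refl)
    ... | from-apex (inj₂ refl) = ⊥-elim (F-uncut c)
    ... | to-apex (inj₁ refl) = ⊥-elim (c refl)
    ... | to-apex (inj₂ refl) = ⊥-elim (F-uncut (λ e → c (sym e)))

  -- an old edge and the apex edge {0, y}: use the old cut by {p, q} and F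
  cut-old-apex : ∀ {p q y} → p ≢ q → Δ (pair p q) ≡ true → ¬ SameEdge p q a b → InF y →
    TwoEdgeCut Δ' (suc p) (suc q) zero (suc y)
  cut-old-apex {p} {q} {y} p≢q pq-edge pq≠F hy
    with two-edge-cut p q a b p≢q a≢b pq-edge ab-edge pq≠F | other-end y hy
  ... | s , sep , cut | y' , _ , _ , same = extend s (s y') , sep , cut'
    where
    cut' : CutBy Δ' (extend s (s y')) (suc p) (suc q) zero (suc y)
    cut' u w ne h c with view u w ne h
    ... | old {u'} {w'} u'≢w' h' not-F with cut u' w' u'≢w' h' c
    ...   | inj₁ x = inj₁ (same-suc x)
    ...   | inj₂ x = ⊥-elim (not-F x)
    cut' u w ne h c | from-apex hz with end-of-F hz same
    ...   | inj₁ refl = inj₂ (inj₁ (refl , refl))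
    ...   | inj₂ refl = ⊥-elim (c refl)
    cut' u w ne h c | to-apex hz with end-of-F hz same
    ...   | inj₁ refl = inj₂ (inj₂ (refl , refl))
    ...   | inj₂ refl = ⊥-elim (c refl)

  -- the apex edge {0, y} and an old edge: use the old cut by F and {r, t}
  cut-apex-old : ∀ {y r t} → InF y → r ≢ t → Δ (pair r t) ≡ true → ¬ SameEdge r t a b →
    TwoEdgeCut Δ' zero (suc y) (suc r) (suc t)
  cut-apex-old {y} {r} {t} hy r≢t rt-edge rt≠F
    with two-edge-cut a b r t a≢b r≢t ab-edge rt-edge (λ x → rt≠F (same-sym x)) | other-end y hy
  ... | s , sep , cut | y' , _ , _ , same = extend s (s y') , separates-F s sep same , cut'
    where
    cut' : CutBy Δ' (extend s (s y')) zero (suc y) (suc r) (suc t)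
    cut' u w ne h c with view u w ne h
    ... | old {u'} {w'} u'≢w' h' not-F with cut u' w' u'≢w' h' c
    ...   | inj₁ x = ⊥-elim (not-F x)
    ...   | inj₂ x = inj₂ (same-suc x)
    cut' u w ne h c | from-apex hz with end-of-F hz same
    ...   | inj₁ refl = inj₁ (inj₁ (refl , refl))
    ...   | inj₂ refl = ⊥-elim (c refl)
    cut' u w ne h c | to-apex hz with end-of-F hz same
    ...   | inj₁ refl = inj₁ (inj₂ (refl , refl))
    ...   | inj₂ refl = ⊥-elim (c refl)

  apex-only : Fin (suc n) → Bool
  apex-only zero = true
  apex-only (suc _) = false

  cut-apex-apex : ∀ {y y'} → InF y → InF y' → y ≢ y' → TwoEdgeCut Δ' zero (suc y) zero (suc y')
  cut-apex-apex {y} {y'} hy hy' y≢y' = apex-only , (λ ()) , cut'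
    where
    cut' : CutBy Δ' apex-only zero (suc y) zero (suc y')
    cut' u w ne h c with view u w ne h
    ... | old _ _ _ = ⊥-elim (c refl)
    ... | from-apex hz with end-of-F' hz hy hy' y≢y'
    ...   | inj₁ refl = inj₁ (inj₁ (refl , refl))
    ...   | inj₂ refl = inj₂ (inj₁ (refl , refl))
    cut' u w ne h c | to-apex hz with end-of-F' hz hy hy' y≢y'
    ...   | inj₁ refl = inj₁ (inj₂ (refl , refl))
    ...   | inj₂ refl = inj₂ (inj₂ (refl , refl))

  two-edge-cut' : ∀ p q r t → p ≢ q → r ≢ t → Δ' (pair p q) ≡ true → Δ' (pair r t) ≡ true →
    ¬ SameEdge p q r t → TwoEdgeCut Δ' p q r t
  two-edge-cut' p q r t p≢q r≢t pq-edge rt-edge pq≠rt with view p q p≢q pq-edge | view r t r≢t rt-edge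
  ... | old x₁ x₂ x₃ | old y₁ y₂ y₃ = cut-old-old x₁ y₁ x₂ y₂ x₃ y₃ (λ x → pq≠rt (same-suc x))
  ... | old x₁ x₂ x₃ | from-apex hy = cut-old-apex x₁ x₂ x₃ hy
  ... | old x₁ x₂ x₃ | to-apex hy = cut-flipʳ {Δ = Δ'} (cut-old-apex x₁ x₂ x₃ hy)
  ... | from-apex hy | old y₁ y₂ y₃ = cut-apex-old hy y₁ y₂ y₃
  ... | to-apex hy | old y₁ y₂ y₃ = cut-flipˡ {Δ = Δ'} (cut-apex-old hy y₁ y₂ y₃)
  ... | from-apex hy | from-apex hy' = cut-apex-apex hy hy' (λ { refl → pq≠rt (inj₁ (refl , refl)) })
  ... | from-apex hy | to-apex hy' =
    cut-flipʳ {Δ = Δ'} (cut-apex-apex hy hy' (λ { refl → pq≠rt (inj₂ (refl , refl)) }))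
  ... | to-apex hy | from-apex hy' =
    cut-flipˡ {Δ = Δ'} (cut-apex-apex hy hy' (λ { refl → pq≠rt (inj₂ (refl , refl)) }))
  ... | to-apex hy | to-apex hy' =
    cut-flipˡ {Δ = Δ'} (cut-flipʳ {Δ = Δ'} (cut-apex-apex hy hy' (λ { refl → pq≠rt (inj₁ (refl , refl)) })))

  cycleLike' : CycleLike Δ'
  cycleLike' = record { neighbour = neighbour' ; reconnect = reconnect' ; two-edge-cut = two-edge-cut' }

size-zero : ∀ {n} (F : Subset n) → ∣ F ∣ ≡ 0 → F ≡ ∅
size-zero [] e = refl
size-zero (false ∷ F) e = cong (false ∷_) (size-zero F e)

size-one : ∀ {n} (F : Subset n) → ∣ F ∣ ≡ 1 → Σ (Fin n) λ c → F ≡ ⁅ c ⁆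
size-one (true ∷ F) e = zero , cong (true ∷_) (size-zero F (NP.suc-injective e))
size-one (false ∷ F) e with size-one F e
... | c , eq = suc c , cong (false ∷_) eq

size-two : ∀ {n} (F : Subset n) → ∣ F ∣ ≡ 2 → Σ (Fin n) λ a → Σ (Fin n) λ b → a ≢ b × F ≡ pair a b
size-two (true ∷ F) e with size-one F (NP.suc-injective e)
... | c , eq = zero , suc c , (λ ()) , cong (true ∷_) (trans eq (sym (∅∪ ⁅ c ⁆)))
size-two (false ∷ F) e with size-two F e
... | a , b , a≢b , eq = suc a , suc b , (λ x → a≢b (FP.suc-injective x)) , cong (false ∷_) eq

stacked-polygon-cycleLike : ∀ {n Δ} → Stacked 2 n Δ → CycleLike Δ
stacked-polygon-cycleLike simplex = triangle-cycleLike
stacked-polygon-cycleLike (stack {n} {Δ} s F hF sz) with size-two F sz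
... | a , b , a≢b , refl = CycleLikeStep.cycleLike' Δ a b a≢b hF (NP.≤-reflexive (sym sz))
                             (stacked-polygon-cycleLike s)

module PolygonStep {n} (Δ : Complex n) (p q : Fin n) (p≢q : p ≢ q) (pq-edge : Δ (pair p q) ≡ true)
  (cyc : CycleLike Δ) where
  F = pair p q
  Δ₀ = remove Δ F

  splitting : Subset n → Bool
  splitting W = subsetᵇ F W ∧ not (fullᵇ W)

  nc-delete-F : ∀ W → + nc Δ₀ W - + 1 ≡ (+ nc Δ W - + 1) + + ι (splitting W)
  nc-delete-F W rewrite subsetᵇ-pair p q W with lookup W p ∧ lookup W q in e
  ... | false = trans (cong (λ z → + z - + 1) (D.nc-deletion-outside e)) (sym (ℤP.+-identityʳ _))
    where module D = EdgeDeletion Δ p q p≢q pq-edge W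
  ... | true with ∧-true (lookup W p) _ e | fullᵇ W in f
  ...   | wp , wq | true =
          trans (cong (λ z → + z - + 1) (D.nc-deletion-joined (C.joined-if-full (fullᵇ-lookup W f))))
                (sym (ℤP.+-identityʳ _))
    where
    module D = EdgeDeletion Δ p q p≢q pq-edge W
    module C = CycleConsequences Δ cyc p q p≢q pq-edge W
  ...   | wp , wq | false with fullᵇ-missing W f
  ...     | c , wc =
          trans (cong (λ z → + z - + 1) (D.nc-deletion-bridge wp wq (C.separated-if-missing c wc wp wq)))
                (shift (+ nc Δ W))
    where
    module D = EdgeDeletion Δ p q p≢q pq-edge W
    module C = CycleConsequences Δ cyc p q p≢q pq-edge W
    shift : ∀ x → (+ 1 + x) - + 1 ≡ (x - + 1) + + 1
    shift = solve-∀

  count-splitting : ∣ F ∣ ≡ 2 → ∀ j → sumSize j (λ W → + ι (splitting W)) ≡ + shiftedC (n ∸ 2) j 2 - + ι (j ≡ᵇ n)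
  count-splitting sz j =
    trans (sumSize-cong j _ _ difference)
    (trans (sumSize-+ {n} j _ _)
    (cong₂ _+_ (trans (count-supersets F j) (cong (λ z → + shiftedC (n ∸ z) j z) sz))
               (trans (sumSize-neg {n} j _) (cong -_ (count-full {n} j)))))
    where
    -- a full W contains F
    ι-and-not : ∀ x f → (f ≡ true → x ≡ true) → + ι (x ∧ not f) ≡ + ι x - + ι f
    ι-and-not true true _ = refl
    ι-and-not true false _ = refl
    ι-and-not false false _ = refl
    ι-and-not false true h with h refl
    ... | ()
    difference : ∀ W → + ι (splitting W) ≡ + ι (subsetᵇ F W) + - + ι (fullᵇ W)
    difference W = ι-and-not _ _ (λ h → subsetᵇ-complete F W (λ i _ → fullᵇ-lookup W h i))

  b-delete-F : ∣ F ∣ ≡ 2 → ∀ j →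
    sumSize j (λ W → + nc Δ₀ W - + 1) ≡ b j Δ + (+ shiftedC (n ∸ 2) j 2 - + ι (j ≡ᵇ n))
  b-delete-F sz j =
    trans (sumSize-cong j _ _ nc-delete-F)
      (trans (sumSize-+ {n} j _ _) (cong₂ _+_ (sym (b-as-sum j Δ)) (count-splitting sz j)))

  F-edges : ∀ a' b' → lookup F a' ≡ true → lookup F b' ≡ true → a' ≢ b' → Δ (pair a' b') ≡ true
  F-edges a' b' ha hb ne with ∈pair p q a' ha | ∈pair p q b' hb
  ... | inj₁ refl | inj₁ refl = ⊥-elim (ne refl)
  ... | inj₁ refl | inj₂ refl = pq-edge
  ... | inj₂ refl | inj₁ refl = trans (cong Δ (pair-comm q p)) pq-edge
  ... | inj₂ refl | inj₂ refl = ⊥-elim (ne refl)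

polygonB : ℕ → ℕ → ℤ
polygonB n k = + n * + shiftedC (n ∸ 2) k 1 - + (n C k) + + ι (k ≡ᵇ n)

polygonB-triangle : ∀ k → - (+ (0 C k)) ≡ polygonB 3 k
polygonB-triangle zero = refl
polygonB-triangle (suc zero) = refl
polygonB-triangle (suc (suc zero)) = refl
polygonB-triangle (suc (suc (suc zero))) = refl
polygonB-triangle (suc (suc (suc (suc k)))) = refl

polygonB-step-zero′ : ∀ m → polygonB (suc (suc m)) 0 + (+ shiftedC m 0 2 - + ι (0 ≡ᵇ suc (suc m)))
                           ≡ polygonB (suc (suc (suc m))) 0
polygonB-step-zero′ m = identity (+ suc (suc m)) (+ suc (suc (suc m)))
  where
  identity : ∀ x y → x * + 0 - + 1 + + 0 + (+ 0 - + 0) ≡ y * + 0 - + 1 + + 0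
  identity = solve-∀

polygonB-step-suc′ : ∀ m j →
  (polygonB (suc (suc m)) j + + (m C j))
    + (polygonB (suc (suc m)) (suc j) + (+ shiftedC m (suc j) 2 - + ι (suc j ≡ᵇ suc (suc m))))
  ≡ polygonB (suc (suc (suc m))) (suc j)
polygonB-step-suc′ m j =
  trans (regroup (+ suc (suc m)) (+ shiftedC m j 1) (+ (m C j)) (+ (suc (suc m) C j)) (+ (suc (suc m) C suc j))
                 (+ ι (j ≡ᵇ suc (suc m))) (+ ι (suc j ≡ᵇ suc (suc m))))
    (cong₂ (λ x y → (+ 1 + + suc (suc m)) * x - y + + ι (j ≡ᵇ suc (suc m)))
       (trans (sym (ℤP.pos-+ (shiftedC m j 1) _)) (cong +_ (sym (pascal-shift m j))))
       (trans (sym (ℤP.pos-+ (suc (suc m) C j) _)) (cong +_ (NC.nCk+nC[k+1]≡[n+1]C[k+1] (suc (suc m)) j))))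
  where
  pascal-shift : ∀ m j → suc m C j ≡ shiftedC m j 1 +ℕ m C j
  pascal-shift m zero = refl
  pascal-shift m (suc j) = sym (NC.nCk+nC[k+1]≡[n+1]C[k+1] m j)
  regroup : ∀ N cm c Pj Ps i₁ i₂ → ((N * cm - Pj + i₁) + c) + ((N * c - Ps + i₂) + (cm - i₂))
            ≡ (+ 1 + N) * (cm + c) - (Pj + Ps) + i₁
  regroup = solve-∀

polygonB-step-zero : ∀ n → 2 ≤ n → polygonB n 0 + (+ shiftedC (n ∸ 2) 0 2 - + ι (0 ≡ᵇ n)) ≡ polygonB (suc n) 0
polygonB-step-zero (suc (suc m)) _ = polygonB-step-zero′ m
polygonB-step-zero (suc zero) (s≤s ())

polygonB-step-suc : ∀ n → 2 ≤ n → ∀ j →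
  (polygonB n j + + ((n ∸ 2) C j)) + (polygonB n (suc j) + (+ shiftedC (n ∸ 2) (suc j) 2 - + ι (suc j ≡ᵇ n)))
  ≡ polygonB (suc n) (suc j)
polygonB-step-suc (suc (suc m)) _ j = polygonB-step-suc′ m j
polygonB-step-suc (suc zero) (s≤s ()) j

-- One stacking step preserves the closed form.  (n stays a variable here:
-- b of a concrete vertex count would be unfolded by the typechecker.)
polygon-step : ∀ {n} {Δ : Complex n} → 2 ≤ n → CycleLike Δ → ∀ p q → p ≢ q → Δ (pair p q) ≡ true →
  ∣ pair p q ∣ ≡ 2 → (∀ k → b k Δ ≡ polygonB n k) →
  ∀ k → b k (stackStep Δ (pair p q)) ≡ polygonB (suc n) k
polygon-step {n} {Δ} n≥2 cyc p q p≢q pq-edge sz IH = formula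
  where
  module P = PolygonStep Δ p q p≢q pq-edge cyc
  module R = Recurrence Δ (pair p q) (NP.≤-reflexive (sym sz)) P.F-edges
  new : ℕ → ℤ
  new j = + shiftedC (n ∸ 2) j 2 - + ι (j ≡ᵇ n)
  formula : ∀ k → b k (stackStep Δ (pair p q)) ≡ polygonB (suc n) k
  formula zero =
    begin
      b 0 (stackStep Δ (pair p q))
    ≡⟨ R.b-zero ⟩
      sumSize 0 (λ W → + nc (remove Δ (pair p q)) W - + 1)
    ≡⟨ P.b-delete-F sz 0 ⟩
      b 0 Δ + new 0
    ≡⟨ cong (_+ new 0) (IH 0) ⟩
      polygonB n 0 + new 0
    ≡⟨ polygonB-step-zero n n≥2 ⟩
      polygonB (suc n) 0
    ∎
    where open ≡-Reasoning
  formula (suc j) =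
    begin
      b (suc j) (stackStep Δ (pair p q))
    ≡⟨ R.b-suc j ⟩
      (b j Δ + + ((n ∸ ∣ pair p q ∣) C j)) + sumSize (suc j) (λ W → + nc (remove Δ (pair p q)) W - + 1)
    ≡⟨ cong₂ _+_ (cong₂ _+_ (IH j) (cong (λ z → + ((n ∸ z) C j)) sz)) (P.b-delete-F sz (suc j)) ⟩
      (polygonB n j + + ((n ∸ 2) C j)) + (b (suc j) Δ + new (suc j))
    ≡⟨ cong (λ z → (polygonB n j + + ((n ∸ 2) C j)) + (z + new (suc j))) (IH (suc j)) ⟩
      (polygonB n j + + ((n ∸ 2) C j)) + (polygonB n (suc j) + new (suc j))
    ≡⟨ polygonB-step-suc n n≥2 j ⟩
      polygonB (suc n) (suc j)
    ∎
    where open ≡-Reasoning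

b-stacked-polygon : ∀ {n Δ} → Stacked 2 n Δ → ∀ k → b k Δ ≡ polygonB n k
b-stacked-polygon simplex k = trans (b-simplex 2 NP.≤-refl k) (polygonB-triangle k)
b-stacked-polygon (stack {n} {Δ} s F hF sz) with size-two F sz
... | p , q , p≢q , F≡pq =
  subst (λ X → ∀ k → b k (stackStep Δ X) ≡ polygonB (suc n) k) (sym F≡pq)
    (polygon-step (NP.≤-trans (NP.n≤1+n 2) (stacked-size s)) (stacked-polygon-cycleLike s) p q p≢q
                  (subst (λ X → Δ X ≡ true) F≡pq hF) (subst (λ X → ∣ X ∣ ≡ 2) F≡pq sz) (b-stacked-polygon s))

absorption : ∀ m j → (+ m - + j) * + (m C j) ≡ (+ j + + 1) * + (m C suc j)
absorption zero zero = refl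
absorption zero (suc j) = trans (ℤP.*-zeroʳ (+ 0 - + suc j)) (sym (ℤP.*-zeroʳ (+ suc j + + 1)))
absorption (suc m) zero = trans (identity (+ suc m)) (cong (λ z → + 1 * + z) (sym (NC.nC1≡n (suc m))))
  where
  identity : ∀ x → (x - + 0) * + 1 ≡ + 1 * x
  identity = solve-∀
absorption (suc m) (suc j) =
  begin
    (+ suc m - + suc j) * + (suc m C suc j)
  ≡⟨ cong (λ z → (+ suc m - + suc j) * + z) (sym (NC.nCk+nC[k+1]≡[n+1]C[k+1] m j)) ⟩
    (+ suc m - + suc j) * (c₀ + c₁)
  ≡⟨ distribute (+ m) (+ j) c₀ c₁ ⟩
    (+ m - + j) * c₀ + (+ m - + j) * c₁
  ≡⟨ cong (_+ (+ m - + j) * c₁) (absorption m j) ⟩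
    (+ j + + 1) * c₁ + (+ m - + j) * c₁
  ≡⟨ shift (+ m) (+ j) c₁ ⟩
    (+ suc j + + 1) * c₁ + ((+ m - + suc j) * c₁)
  ≡⟨ cong (λ z → (+ suc j + + 1) * c₁ + z) (absorption m (suc j)) ⟩
    (+ suc j + + 1) * c₁ + (+ suc j + + 1) * c₂
  ≡⟨ sym (ℤP.*-distribˡ-+ (+ suc j + + 1) c₁ c₂) ⟩
    (+ suc j + + 1) * (c₁ + c₂)
  ≡⟨ cong (λ z → (+ suc j + + 1) * + z) (NC.nCk+nC[k+1]≡[n+1]C[k+1] m (suc j)) ⟩
    (+ suc j + + 1) * + (suc m C suc (suc j))
  ∎
  where
  open ≡-Reasoning
  c₀ = + (m C j)
  c₁ = + (m C suc j)
  c₂ = + (m C suc (suc j))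
  distribute : ∀ M J a b → ((+ 1 + M) - (+ 1 + J)) * (a + b) ≡ (M - J) * a + (M - J) * b
  distribute = solve-∀
  shift : ∀ M J a → (J + + 1) * a + (M - J) * a ≡ ((+ 1 + J) + + 1) * a + (M - (+ 1 + J)) * a
  shift = solve-∀

absorption-top : ∀ m k → (+ suc m - + k) * + (suc m C k) ≡ + suc m * + (m C k)
absorption-top m zero = identity (+ suc m)
  where
  identity : ∀ x → (x - + 0) * + 1 ≡ x * + 1
  identity = solve-∀
absorption-top m (suc j) =
  begin
    (+ suc m - + suc j) * + (suc m C suc j)
  ≡⟨ cong (λ z → (+ suc m - + suc j) * + z) (sym (NC.nCk+nC[k+1]≡[n+1]C[k+1] m j)) ⟩
    (+ suc m - + suc j) * (c₀ + c₁)
  ≡⟨ distribute (+ m) (+ j) c₀ c₁ ⟩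
    (+ m - + j) * c₀ + (+ m - + j) * c₁
  ≡⟨ cong (_+ (+ m - + j) * c₁) (absorption m j) ⟩
    (+ j + + 1) * c₁ + (+ m - + j) * c₁
  ≡⟨ collect (+ m) (+ j) c₁ ⟩
    + suc m * c₁
  ∎
  where
  open ≡-Reasoning
  c₀ = + (m C j)
  c₁ = + (m C suc j)
  distribute : ∀ M J a b → ((+ 1 + M) - (+ 1 + J)) * (a + b) ≡ (M - J) * a + (M - J) * b
  distribute = solve-∀
  collect : ∀ M J a → (J + + 1) * a + (M - J) * a ≡ (+ 1 + M) * a
  collect = solve-∀

≡ᵇ-refl : ∀ n → (n ≡ᵇ n) ≡ true
≡ᵇ-refl zero = refl
≡ᵇ-refl (suc n) = ≡ᵇ-refl n

≢⇒≡ᵇ-false : ∀ k n → k ≢ n → (k ≡ᵇ n) ≡ false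
≢⇒≡ᵇ-false zero zero ne = ⊥-elim (ne refl)
≢⇒≡ᵇ-false zero (suc n) ne = refl
≢⇒≡ᵇ-false (suc k) zero ne = refl
≢⇒≡ᵇ-false (suc k) (suc n) ne = ≢⇒≡ᵇ-false k n (λ e → ne (cong suc e))

-- b_n = 0: the whole polygon is connected.
polygonB-top : ∀ m → polygonB (suc (suc m)) (suc (suc m)) ≡ + 0
polygonB-top m rewrite NC.k>n⇒nCk≡0 {m} {suc m} (NP.n<1+n m) | NC.nCn≡1 (suc (suc m)) | ≡ᵇ-refl m =
  identity (+ suc (suc m))
  where
  identity : ∀ x → x * + 0 - + 1 + + 1 ≡ + 0
  identity = solve-∀

polygonB-paper : ∀ m k → k ≢ suc (suc m) →
  (+ suc (suc m) - + k) * polygonB (suc (suc m)) k ≡ + suc (suc m) * (+ k - + 1) * + (m C k)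
polygonB-paper m k k≢n rewrite ≢⇒≡ᵇ-false k (suc (suc m)) k≢n = go k
  where
  N = + suc (suc m)
  go : ∀ k → (N - + k) * (N * + shiftedC m k 1 - + (suc (suc m) C k) + + 0) ≡ N * (+ k - + 1) * + (m C k)
  go zero = identity N
    where
    identity : ∀ x → (x - + 0) * (x * + 0 - + 1 + + 0) ≡ x * (+ 0 - + 1) * + 1
    identity = solve-∀
  go (suc j) =
    begin
      (N - + suc j) * (N * c₀ - P + + 0)
    ≡⟨ expand N (+ suc j) c₀ P ⟩
      (N - + suc j) * (N * c₀) - (N - + suc j) * P
    ≡⟨ cong (λ z → (N - + suc j) * (N * c₀) - z) (absorption-top (suc m) (suc j)) ⟩
      (N - + suc j) * (N * c₀) - N * + (suc m C suc j)
    ≡⟨ cong (λ z → (N - + suc j) * (N * c₀) - N * + z) (sym (NC.nCk+nC[k+1]≡[n+1]C[k+1] m j)) ⟩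
      (N - + suc j) * (N * c₀) - N * (c₀ + c₁)
    ≡⟨ factor (+ m) (+ j) c₀ c₁ ⟩
      N * ((+ m - + j) * c₀ - c₁)
    ≡⟨ cong (λ z → N * (z - c₁)) (absorption m j) ⟩
      N * ((+ j + + 1) * c₁ - c₁)
    ≡⟨ collect N (+ j) c₁ ⟩
      N * (+ suc j - + 1) * c₁
    ∎
    where
    open ≡-Reasoning
    c₀ = + (m C j)
    c₁ = + (m C suc j)
    P = + (suc (suc m) C suc j)
    expand : ∀ x y c p → (x - y) * (x * c - p + + 0) ≡ (x - y) * (x * c) - (x - y) * p
    expand = solve-∀
    factor : ∀ M J a b → ((+ 2 + M) - (+ 1 + J)) * ((+ 2 + M) * a) - (+ 2 + M) * (a + b)
                         ≡ (+ 2 + M) * ((M - J) * a - b)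
    factor = solve-∀
    collect : ∀ x J c → x * ((J + + 1) * c - c) ≡ x * ((+ 1 + J) - + 1) * c
    collect = solve-∀

b-stacked-polygon-paper : ∀ {n Δ} → Stacked 2 n Δ → ∀ k →
  (k ≡ n → b k Δ ≡ + 0) × (k ≢ n → (+ n - + k) * b k Δ ≡ + n * (+ k - + 1) * + ((n ∸ 2) C k))
b-stacked-polygon-paper {zero} s k = ⊥-elim (NP.≤⇒≯ (stacked-size s) (s≤s z≤n))
b-stacked-polygon-paper {suc zero} s k = ⊥-elim (NP.≤⇒≯ (stacked-size s) (s≤s (s≤s z≤n)))
b-stacked-polygon-paper {suc (suc m)} s k =
  (λ { refl → trans (b-stacked-polygon s (suc (suc m))) (polygonB-top m) }) ,
  (λ k≢n → trans (cong ((+ suc (suc m) - + k) *_) (b-stacked-polygon s k)) (polygonB-paper m k k≢n))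

theorem3p9 : (d n : ℕ) (Δ : Complex n) → Stacked d n Δ →
    (3 ≤ d → (k : ℕ) → b k Δ ≡ (+ k - + 1) * + ((n ∸ d) C k))
    × (d ≡ 2 → (k : ℕ) →
        (k ≡ n → b k Δ ≡ + 0)
        × (k ≢ n → (+ n - + k) * b k Δ ≡ + n * (+ k - + 1) * + ((n ∸ 2) C k)))
theorem3p9 d n Δ s =
  (λ d≥3 → b-stacked-high d≥3 s) ,
  (λ { refl → b-stacked-polygon-paper s })
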